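{- Fix integers $t\ge 2$ and $\omega\ge 2$, and for $\Delta\ge 2$ let $a=\lfloor \Delta/(\omega-1)\rfloor$. Then as $\Delta\to\infty$, \[ f_t(\Delta,\omega)=(1+o(1))\,\rho_t\big(T_\omega(\Delta+a)\big)=(1+o(1))\,\frac1t\binom{\omega-1}{t-1}\left(\frac{\Delta}{\omega-1}\right)^{t-1}. \]
   Context: All graphs are finite and simple. For integers $\Delta,\omega$, let $\mathcal{G}(\Delta,\omega)$ be the class of graphs $G$ with maximum degree $\Delta(G)\le\Delta$ and clique number $\omega(G)\le\omega$. For a graph $G$, $k_t(G)$ denotes the number of copies of $K_t$ in $G$, and $\rho_t(G)=k_t(G)/|V(G)|$. For a positive integer $n$ let $k_t(n,\Delta,\omega)=\max\{k_t(G): |V(G)|=n,\ G\in\mathcal{G}(\Delta,\omega)\}$, and define $f_t(\Delta,\omega)=\lim_{n\to\infty}k_t(n,\Delta,\omega)/n$ (this limit exists and equals $\sup_{n}k_t(n,\Delta,\omega)/n$). $T_r(n)$ denotes the Turán graph: the complete $r$-partite graph on $n$ vertices whose part sizes differ by at most one. -}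

module Defs where

open import Data.Nat using (ℕ; zero; suc; _+_; _*_; _∸_; _^_; _≤_; _%_; _/_; _≡ᵇ_)
open import Data.Bool using (Bool; true; false; _∧_; _∨_; not; if_then_else_)
open import Data.Fin using (Fin; toℕ; _≟_)
open import Data.Vec using (Vec; []; _∷_; lookup)
open import Data.List using (List; []; _∷_; map; _++_)
open import Relation.Nullary.Decidable using (⌊_⌋)
open import Relation.Binary.PropositionalEquality using (_≡_)

countFin : ∀ n → (Fin n → Bool) → ℕ
countFin zero    p = 0
countFin (suc n) p = (if p Fin.zero then 1 else 0) + countFin n (λ i → p (Fin.suc i))

Subset : ℕ → Set
Subset n = Vec Bool n

allSubsets : ∀ n → List (Subset n)
allSubsets zero    = [] ∷ []
allSubsets (suc n) = map (false ∷_) (allSubsets n) ++ map (true ∷_) (allSubsets n)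

size : ∀ {n} → Subset n → ℕ
size []          = 0
size (true ∷ s)  = suc (size s)
size (false ∷ s) = size s

Adj : ℕ → Set
Adj n = Fin n → Fin n → Bool

isClique : ∀ {n} → Adj n → Subset n → Bool
isClique {n} adj S =
  -- no vertex i has a "bad" partner j (j ≠ i, both in S, not adjacent)
  countFin n (λ i → not (countFin n (λ j →
     lookup S i ∧ lookup S j ∧ not ⌊ i ≟ j ⌋ ∧ not (adj i j)) ≡ᵇ 0)) ≡ᵇ 0

countList : ∀ {A : Set} → (A → Bool) → List A → ℕ
countList p []       = 0
countList p (x ∷ xs) = (if p x then 1 else 0) + countList p xs

kt : ∀ {n} → ℕ → Adj n → ℕ
kt {n} t adj = countList (λ S → isClique adj S ∧ (size S ≡ᵇ t)) (allSubsets n)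

record Graph (n : ℕ) : Set where
  field
    adj   : Adj n
    sym   : ∀ i j → adj i j ≡ adj j i
    irrefl : ∀ i → adj i i ≡ false
open Graph public

degree : ∀ {n} → Graph n → Fin n → ℕ
degree {n} G i = countFin n (adj G i)

InClass : ∀ {n} → ℕ → ℕ → Graph n → Set
InClass {n} Δ ω G =
  (∀ i → degree G i ≤ Δ) × (∀ S → isClique (adj G) S ≡ true → size S ≤ ω)
  where open import Data.Product using (_×_)

-- residue / quotient that are total in the divisor (only used with divisor ≥ 1).
modℕ : ℕ → ℕ → ℕ
modℕ x zero    = x
modℕ x (suc r) = x % suc r

divℕ : ℕ → ℕ → ℕ
divℕ x zero    = 0
divℕ x (suc r) = x / suc r

-- Turán graph T_r(m) on Fin m: parts are residue classes mod r
-- (part sizes differ by at most one); adjacent iff in different parts.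
turanAdj : (r m : ℕ) → Adj m
turanAdj r m i j = not (modℕ (toℕ i) r ≡ᵇ modℕ (toℕ j) r)

-- For weights w on the vertices let Q_s(w) be the sum over the s-cliques of the products of
-- their weights, so that k_t(G) = Q_t(1) and t · k_t(G) = Σ_v Q_{t−1}(1 on N(v)).
-- Upper bound: on a neighbourhood N(v), Zykov symmetrization (moving the weight of a vertex
-- onto a non-adjacent vertex with a larger link) never decreases Q_{t−1} and ends with all the
-- weight on a clique of N(v), hence on at most r = ω − 1 vertices; balancing these weights on
-- a complete graph towards the cap b = ⌊Δ/r⌋ + 1 (Maclaurin) gives Q_{t−1} ≤ C(r, t−1) b^{t−1},
-- so t · k_t(G) ≤ n C(r, t−1) b^{t−1}.
-- Lower bound: the Turán graph T_ω(Δ + a), a = ⌊Δ/r⌋, lies in 𝒢(Δ, ω) and every vertex sees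
-- r parts of at least a vertices, so t · k_t ≥ (Δ + a) C(r, t−1) a^{t−1}.
-- Since (a + 1)^{t−1} ≤ (1 + 1/q) a^{t−1} once a ≥ (q + 1) t, the two bounds agree up to the
-- factor (q + 1)/q of the statement.
module Submission where

open import Defs hiding (sym)
open import Data.Nat using (ℕ; zero; suc; pred; _+_; _*_; _^_; _∸_; _≤_; _<_; z≤n; s≤s; _≡ᵇ_; >-nonZero)
open import Data.Nat.Properties hiding (_≟_)
open import Data.Nat.Properties using () renaming (_≟_ to _≟ℕ_)
open import Data.Bool using (Bool; true; false; not; _∧_; _∨_; if_then_else_)
open import Data.Vec using (_∷_; []; lookup; tabulate)
open import Data.List using ([]; _∷_; map; _++_)
open import Data.Vec.Properties using (lookup∘tabulate)
open import Data.Fin using (Fin; _≟_; zero; suc; toℕ; fromℕ<)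
open import Data.Nat.DivMod using (_%_; _/_; [m+n]%n≡m%n; m<n⇒m%n≡m; m%n<n; m/n*n≤m; m≡m%n+[m/n]*n; /-monoˡ-≤; m*n/n≡m)
open import Function.Bundles using (Equivalence)
open import Data.Nat.Combinatorics using (_C_; nCk+nC[k+1]≡[n+1]C[k+1])
open import Relation.Nullary.Decidable using (⌊_⌋; yes; no; Dec; _×-dec_; ¬?)
open import Data.Fin.Properties using (any?; all?; ¬∀⟶∃¬; toℕ-injective; toℕ-fromℕ<; toℕ<n) renaming (suc-injective to Fin-suc-injective)
import Data.Bool.Properties as Bool
open import Relation.Binary.PropositionalEquality
open import Data.Empty using (⊥-elim)
open import Data.Sum using (_⊎_; inj₁; inj₂)
open import Relation.Nullary using (¬_)
open import Data.Product using (_×_; _,_; proj₂; Σ-syntax; ∃; ∃-syntax)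
open import Algebra.Properties.Semiring.Sum +-*-semiring using (sum; sum-syntax; sum-cong-≗; ∑-distrib-+; *-distribˡ-sum)
open import Algebra.Properties.CommutativeSemigroup *-commutativeSemigroup using (x∙yz≈y∙xz)
open import Data.Nat.Tactic.RingSolver

true≢false : true ≢ false
true≢false ()

Bool-ext : ∀ {a b} → (a ≡ true → b ≡ true) → (b ≡ true → a ≡ true) → a ≡ b
Bool-ext {true}  {true}  _   _   = refl
Bool-ext {true}  {false} a⇒b _   with () ← a⇒b refl
Bool-ext {false} {true}  _   b⇒a with () ← b⇒a refl
Bool-ext {false} {false} _   _   = refl

∧-intro : ∀ {a b} → a ≡ true → b ≡ true → (a ∧ b) ≡ true
∧-intro refl refl = refl

∧-elimˡ : ∀ a {b} → (a ∧ b) ≡ true → a ≡ true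
∧-elimˡ true _ = refl

∧-elimʳ : ∀ a {b} → (a ∧ b) ≡ true → b ≡ true
∧-elimʳ true b≡true = b≡true

𝟙 : Bool → ℕ
𝟙 b = if b then 1 else 0

𝟙≤1 : ∀ b → 𝟙 b ≤ 1
𝟙≤1 true  = ≤-refl
𝟙≤1 false = z≤n

≟-refl : ∀ {n} (i : Fin n) → ⌊ i ≟ i ⌋ ≡ true
≟-refl i with i ≟ i
... | yes _ = refl
... | no i≢i = ⊥-elim (i≢i refl)

≟-suc : ∀ {n} (i j : Fin n) → ⌊ suc i ≟ suc j ⌋ ≡ ⌊ i ≟ j ⌋
≟-suc i j with i ≟ j
... | yes _ = refl
... | no _ = refl

≟-≢ : ∀ {n} {i j : Fin n} → i ≢ j → ⌊ i ≟ j ⌋ ≡ false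
≟-≢ {i = i} {j} i≢j with i ≟ j
... | yes i≡j = ⊥-elim (i≢j i≡j)
... | no _ = refl

≟-sym : ∀ {n} (i j : Fin n) → ⌊ i ≟ j ⌋ ≡ ⌊ j ≟ i ⌋
≟-sym i j with i ≟ j | j ≟ i
... | yes _   | yes _   = refl
... | no _    | no _    = refl
... | yes i≡j | no j≢i  = ⊥-elim (j≢i (sym i≡j))
... | no i≢j  | yes j≡i = ⊥-elim (i≢j (sym j≡i))

≡ᵇ-refl : ∀ x → (x ≡ᵇ x) ≡ true
≡ᵇ-refl zero    = refl
≡ᵇ-refl (suc x) = ≡ᵇ-refl x

toℕ-≡ᵇ : ∀ {k} (x y : Fin k) → (toℕ x ≡ᵇ toℕ y) ≡ ⌊ x ≟ y ⌋
toℕ-≡ᵇ x y with x ≟ y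
... | yes refl = ≡ᵇ-refl (toℕ x)
... | no  x≢y  = Bool.¬-not (λ ≡ᵇ-true → x≢y (toℕ-injective (≡ᵇ⇒≡ (toℕ x) (toℕ y) (Bool.T-≡ .Equivalence.from ≡ᵇ-true))))

≡ᵇ0⇒≡0 : ∀ {x} → (x ≡ᵇ 0) ≡ true → x ≡ 0
≡ᵇ0⇒≡0 {zero} _ = refl

≡0⇒≡ᵇ0 : ∀ {x} → x ≡ 0 → (x ≡ᵇ 0) ≡ true
≡0⇒≡ᵇ0 refl = refl

Weights : ℕ → Set
Weights n = Fin n → ℕ

sum-const : ∀ n c → sum {n} (λ _ → c) ≡ n * c
sum-const zero    c = refl
sum-const (suc n) c = cong (c +_) (sum-const n c)

sum-mono-≤ : ∀ {n} {f g : Weights n} → (∀ i → f i ≤ g i) → sum f ≤ sum g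
sum-mono-≤ {zero}  f≤g = z≤n
sum-mono-≤ {suc n} f≤g = +-mono-≤ (f≤g zero) (sum-mono-≤ (λ i → f≤g (suc i)))

sum-mono-< : ∀ {n} {f g : Weights n} → (∀ i → f i ≤ g i) → ∀ v → f v < g v → sum f < sum g
sum-mono-< {suc n} f≤g zero    f<g = +-mono-<-≤ f<g (sum-mono-≤ (λ i → f≤g (suc i)))
sum-mono-< {suc n} f≤g (suc v) f<g = +-mono-≤-< (f≤g zero) (sum-mono-< (λ i → f≤g (suc i)) v f<g)

term≤sum : ∀ {n} (f : Weights n) v → f v ≤ sum f
term≤sum {suc n} f zero    = m≤m+n _ _
term≤sum {suc n} f (suc v) = ≤-trans (term≤sum (λ i → f (suc i)) v) (m≤n+m _ _)

update : ∀ {n} → Weights n → Fin n → ℕ → Weights n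
update w v x i = if ⌊ i ≟ v ⌋ then x else w i

update-self : ∀ {n} (w : Weights n) v x → update w v x v ≡ x
update-self w v x = cong (λ b → if b then x else w v) (≟-refl v)

update-other : ∀ {n} (w : Weights n) {v i} x → i ≢ v → update w v x i ≡ w i
update-other w x i≢v = cong (λ b → if b then x else _) (≟-≢ i≢v)

sum-update : ∀ {n} (w : Weights n) v x → sum (update w v x) + w v ≡ sum w + x
sum-update {suc n} w zero x = exchange x (sum (λ i → w (suc i))) (w zero)
  where exchange : ∀ a b c → a + b + c ≡ c + b + a
        exchange = solve-∀
sum-update {suc n} w (suc v) x = begin
  w zero + sum (λ i → update w (suc v) x (suc i)) + w (suc v)
     ≡⟨ cong (λ z → w zero + z + w (suc v)) (sum-cong-≗ (λ i → cong (λ b → if b then x else w (suc i)) (≟-suc i v))) ⟩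
  w zero + sum (update w′ v x) + w′ v      ≡⟨ +-assoc (w zero) _ _ ⟩
  w zero + (sum (update w′ v x) + w′ v)    ≡⟨ cong (w zero +_) (sum-update w′ v x) ⟩
  w zero + (sum w′ + x)                    ≡⟨ +-assoc (w zero) _ _ ⟨
  w zero + sum w′ + x                      ∎
  where
  w′ : Weights n
  w′ i = w (suc i)
  open ≡-Reasoning

sum-update-map : ∀ {n} (f : ℕ → ℕ) (w : Weights n) v x → sum (λ k → f (update w v x k)) + f (w v) ≡ sum (λ k → f (w k)) + f x
sum-update-map f w v x =
  trans (cong (_+ f (w v)) (sum-cong-≗ (λ k → Bool.if-float f ⌊ k ≟ v ⌋))) (sum-update (λ k → f (w k)) v (f x))

restrict : ∀ {n} → (Fin n → Bool) → Weights n → Weights n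
restrict m w i = if m i then w i else 0

erase : ∀ {n} → Fin n → Weights n → Weights n
erase v w i = if ⌊ i ≟ v ⌋ then 0 else w i

erase-suc : ∀ {n} (v : Fin n) (w : Weights (suc n)) j → erase (suc v) w (suc j) ≡ erase v (λ k → w (suc k)) j
erase-suc v w j = cong (λ b → if b then 0 else w (suc j)) (≟-suc j v)

erase-self : ∀ {n} (w : Weights n) v → erase v w v ≡ 0
erase-self w v = cong (λ b → if b then 0 else w v) (≟-refl v)

erase-other : ∀ {n} (w : Weights n) {v i} → i ≢ v → erase v w i ≡ w i
erase-other w i≢v = cong (λ b → if b then 0 else _) (≟-≢ i≢v)

erase-restrict-comm : ∀ {n} v (m : Fin n → Bool) (w : Weights n) j → erase v (restrict m w) j ≡ restrict m (erase v w) j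
erase-restrict-comm v m w j with ⌊ j ≟ v ⌋ | m j
... | true  | true  = refl
... | true  | false = refl
... | false | _     = refl

restrict-comm : ∀ {n} (m₁ m₂ : Fin n → Bool) (w : Weights n) j → restrict m₁ (restrict m₂ w) j ≡ restrict m₂ (restrict m₁ w) j
restrict-comm m₁ m₂ w j = Bool.if-swap-then (m₁ j) (m₂ j)

restrict-mono : ∀ {n} (m : Fin n → Bool) {w w′ : Weights n} → (∀ i → w i ≤ w′ i) → ∀ i → restrict m w i ≤ restrict m w′ i
restrict-mono m w≤w′ i with m i
... | true  = w≤w′ i
... | false = ≤-refl

restrict-cong : ∀ {n} (m : Fin n → Bool) {w w′ : Weights n} i → (m i ≡ true → w i ≡ w′ i) → restrict m w i ≡ restrict m w′ i
restrict-cong m i eq with m i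
... | true  = eq refl
... | false = refl

positive : ℕ → Bool
positive zero    = false
positive (suc _) = true

positive-true : ∀ {x} → 0 < x → positive x ≡ true
positive-true {suc x} _ = refl

supportSize : ∀ {n} → Weights n → ℕ
supportSize w = sum (λ i → 𝟙 (positive (w i)))

𝟙-positive-mono : ∀ x y → (0 < x → 0 < y) → 𝟙 (positive x) ≤ 𝟙 (positive y)
𝟙-positive-mono zero    y       x>0⇒y>0 = z≤n
𝟙-positive-mono (suc x) zero    x>0⇒y>0 with () ← x>0⇒y>0 (s≤s z≤n)
𝟙-positive-mono (suc x) (suc y) x>0⇒y>0 = ≤-refl

supportSize≤0⇒¬positive : ∀ {n} (w : Weights n) → supportSize w ≤ 0 → ∀ i → ¬ 0 < w i
supportSize≤0⇒¬positive w size≤0 i w>0 with ≤-trans (term≤sum (λ i → 𝟙 (positive (w i))) i) size≤0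
... | le rewrite positive-true w>0 with () ← le

countFin≡sum : ∀ n (p : Fin n → Bool) → countFin n p ≡ sum (λ i → 𝟙 (p i))
countFin≡sum zero    p = refl
countFin≡sum (suc n) p = cong (𝟙 (p zero) +_) (countFin≡sum n (λ i → p (suc i)))

countFin-cong : ∀ n {p q : Fin n → Bool} → (∀ i → p i ≡ q i) → countFin n p ≡ countFin n q
countFin-cong zero    p≡q = refl
countFin-cong (suc n) p≡q = cong₂ _+_ (cong 𝟙 (p≡q zero)) (countFin-cong n (λ i → p≡q (suc i)))

countFin≡0 : ∀ n (p : Fin n → Bool) → (∀ i → p i ≡ false) → countFin n p ≡ 0
countFin≡0 zero    p none = refl
countFin≡0 (suc n) p none rewrite none zero = countFin≡0 n (λ i → p (suc i)) (λ i → none (suc i))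

countFin≡0⇒false : ∀ n (p : Fin n → Bool) → countFin n p ≡ 0 → ∀ i → p i ≡ false
countFin≡0⇒false (suc n) p count≡0 zero    with p zero
... | false = refl
countFin≡0⇒false (suc n) p count≡0 (suc i) with p zero
... | false = countFin≡0⇒false n (λ i → p (suc i)) count≡0 i

countFin-others : ∀ k (v : Fin (suc k)) → countFin (suc k) (λ x → not ⌊ x ≟ v ⌋) ≡ k
countFin-others k v = +-cancelʳ-≡ 1 _ _ (begin
  countFin (suc k) (λ x → not ⌊ x ≟ v ⌋) + 1   ≡⟨ cong (_+ 1) (trans (countFin≡sum (suc k) (λ x → not ⌊ x ≟ v ⌋)) (sum-cong-≗ 𝟙-not)) ⟩
  sum (update (λ _ → 1) v 0) + 1               ≡⟨ sum-update (λ _ → 1) v 0 ⟩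
  sum {suc k} (λ _ → 1) + 0                    ≡⟨ trans (+-identityʳ _) (trans (sum-const (suc k) 1) (trans (*-identityʳ (suc k)) (+-comm 1 k))) ⟩
  k + 1                                        ∎)
  where
  open ≡-Reasoning
  𝟙-not : ∀ x → 𝟙 (not ⌊ x ≟ v ⌋) ≡ update (λ _ → 1) v 0 x
  𝟙-not x with ⌊ x ≟ v ⌋
  ... | true  = refl
  ... | false = refl

countℕ : ℕ → (ℕ → Bool) → ℕ
countℕ zero    f = 0
countℕ (suc N) f = 𝟙 (f 0) + countℕ N (λ y → f (suc y))

countFin-toℕ : ∀ N (f : ℕ → Bool) → countFin N (λ i → f (toℕ i)) ≡ countℕ N f
countFin-toℕ zero    f = refl
countFin-toℕ (suc N) f = cong (𝟙 (f 0) +_) (countFin-toℕ N (λ y → f (suc y)))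

countℕ-cong : ∀ N {f g : ℕ → Bool} → (∀ y → f y ≡ g y) → countℕ N f ≡ countℕ N g
countℕ-cong zero    f≡g = refl
countℕ-cong (suc N) f≡g = cong₂ _+_ (cong 𝟙 (f≡g 0)) (countℕ-cong N (λ y → f≡g (suc y)))

countℕ-+ : ∀ M d (f : ℕ → Bool) → countℕ (M + d) f ≡ countℕ M f + countℕ d (λ y → f (M + y))
countℕ-+ zero    d f = refl
countℕ-+ (suc M) d f = trans (cong (𝟙 (f 0) +_) (countℕ-+ M d (λ y → f (suc y)))) (sym (+-assoc (𝟙 (f 0)) _ _))

countℕ-≥1 : ∀ N (f : ℕ → Bool) y → y < N → f y ≡ true → 1 ≤ countℕ N f
countℕ-≥1 (suc N) f zero    _         f0  rewrite f0 = s≤s z≤n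
countℕ-≥1 (suc N) f (suc y) (s≤s y<N) fy  = ≤-trans (countℕ-≥1 N (λ y → f (suc y)) y y<N fy) (m≤n+m _ _)

-- Every block of r + 1 consecutive numbers contains one number of each residue class.
residue-class-size : ∀ r x → x < suc r → ∀ a → a ≤ countℕ (a * suc r) (λ y → y % suc r ≡ᵇ x)
residue-class-size r x x<r+1 zero    = z≤n
residue-class-size r x x<r+1 (suc a) = begin
  suc a                                                      ≤⟨ +-mono-≤ (countℕ-≥1 (suc r) f x x<r+1 fx) (residue-class-size r x x<r+1 a) ⟩
  countℕ (suc r) f + countℕ (a * suc r) f                    ≡⟨ cong (countℕ (suc r) f +_) (countℕ-cong (a * suc r) periodic) ⟨
  countℕ (suc r) f + countℕ (a * suc r) (λ y → f (suc r + y)) ≡⟨ countℕ-+ (suc r) (a * suc r) f ⟨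
  countℕ (suc a * suc r) f                                   ∎
  where
  open ≤-Reasoning
  f : ℕ → Bool
  f y = y % suc r ≡ᵇ x
  fx : f x ≡ true
  fx rewrite m<n⇒m%n≡m x<r+1 = ≡ᵇ-refl x
  periodic : ∀ y → f (suc r + y) ≡ f y
  periodic y = cong (_≡ᵇ x) (trans (cong (_% suc r) (+-comm (suc r) y)) ([m+n]%n≡m%n y (suc r)))

countList-++ : ∀ {A : Set} (p : A → Bool) xs ys → countList p (xs ++ ys) ≡ countList p xs + countList p ys
countList-++ p []       ys = refl
countList-++ p (x ∷ xs) ys = trans (cong (𝟙 (p x) +_) (countList-++ p xs ys)) (sym (+-assoc (𝟙 (p x)) _ _))

countList-map : ∀ {A B : Set} (p : B → Bool) (f : A → B) xs → countList p (map f xs) ≡ countList (λ x → p (f x)) xs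
countList-map p f []       = refl
countList-map p f (x ∷ xs) = cong (𝟙 (p (f x)) +_) (countList-map p f xs)

countList-cong : ∀ {A : Set} {p q : A → Bool} → (∀ x → p x ≡ q x) → ∀ xs → countList p xs ≡ countList q xs
countList-cong p≡q []       = refl
countList-cong p≡q (x ∷ xs) = cong₂ _+_ (cong 𝟙 (p≡q x)) (countList-cong p≡q xs)

countList-≡0 : ∀ {A : Set} (p : A → Bool) → (∀ x → p x ≡ false) → ∀ xs → countList p xs ≡ 0
countList-≡0 p none []       = refl
countList-≡0 p none (x ∷ xs) rewrite none x = countList-≡0 p none xs

countList-allSubsets-suc : ∀ n (p : Subset (suc n) → Bool) →
  countList p (allSubsets (suc n)) ≡ countList (λ S → p (false ∷ S)) (allSubsets n) + countList (λ S → p (true ∷ S)) (allSubsets n)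
countList-allSubsets-suc n p = trans (countList-++ p (map (false ∷_) (allSubsets n)) (map (true ∷_) (allSubsets n)))
  (cong₂ _+_ (countList-map p (false ∷_) (allSubsets n)) (countList-map p (true ∷_) (allSubsets n)))

countList-allSubsets-≥1 : ∀ n (p : Subset n → Bool) (S : Subset n) → p S ≡ true → 1 ≤ countList p (allSubsets n)
countList-allSubsets-≥1 zero    p []          pS rewrite pS = ≤-refl
countList-allSubsets-≥1 (suc n) p (false ∷ S) pS rewrite countList-allSubsets-suc n p =
  ≤-trans (countList-allSubsets-≥1 n (λ S → p (false ∷ S)) S pS) (m≤m+n _ _)
countList-allSubsets-≥1 (suc n) p (true ∷ S)  pS rewrite countList-allSubsets-suc n p =
  ≤-trans (countList-allSubsets-≥1 n (λ S → p (true ∷ S)) S pS) (m≤n+m _ _)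

binomial : ℕ → ℕ → ℕ
binomial n       zero    = 1
binomial zero    (suc k) = 0
binomial (suc n) (suc k) = binomial n k + binomial n (suc k)

binomial≡C : ∀ n k → binomial n k ≡ n C k
binomial≡C n       zero    = refl
binomial≡C zero    (suc k) = refl
binomial≡C (suc n) (suc k) = trans (cong₂ _+_ (binomial≡C n k) (binomial≡C n (suc k))) (nCk+nC[k+1]≡[n+1]C[k+1] n k)

binomial-monoˡ : ∀ k {m n} → m ≤ n → binomial m k ≤ binomial n k
binomial-monoˡ zero    m≤n       = ≤-refl
binomial-monoˡ (suc k) z≤n       = z≤n
binomial-monoˡ (suc k) (s≤s m≤n) = +-mono-≤ (binomial-monoˡ k m≤n) (binomial-monoˡ (suc k) m≤n)

tailAdj : ∀ {n} → Adj (suc n) → Adj n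
tailAdj adj i j = adj (suc i) (suc j)

Symmetric : ∀ {n} → Adj n → Set
Symmetric adj = ∀ i j → adj i j ≡ adj j i

Irreflexive : ∀ {n} → Adj n → Set
Irreflexive adj = ∀ i → adj i i ≡ false

tail-symmetric : ∀ {n} {adj : Adj (suc n)} → Symmetric adj → Symmetric (tailAdj adj)
tail-symmetric sym-adj i j = sym-adj (suc i) (suc j)

tail-irreflexive : ∀ {n} {adj : Adj (suc n)} → Irreflexive adj → Irreflexive (tailAdj adj)
tail-irreflexive irr i = irr (suc i)

completeAdj : ∀ n → Adj n
completeAdj n i j = not ⌊ i ≟ j ⌋

completeAdj-tail : ∀ n i j → tailAdj (completeAdj (suc n)) i j ≡ completeAdj n i j
completeAdj-tail n i j = cong not (≟-suc i j)

completeAdj-symmetric : ∀ n → Symmetric (completeAdj n)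
completeAdj-symmetric n i j = cong not (≟-sym i j)

completeAdj-irreflexive : ∀ n → Irreflexive (completeAdj n)
completeAdj-irreflexive n i = cong not (≟-refl i)

restrict-completeAdj : ∀ n (i : Fin n) (w : Weights n) k → restrict (completeAdj n i) w k ≡ erase i w k
restrict-completeAdj n i w k rewrite ≟-sym i k with ⌊ k ≟ i ⌋
... | true  = refl
... | false = refl

IsClique : ∀ {n} → Adj n → Subset n → Set
IsClique adj S = ∀ i j → lookup S i ≡ true → lookup S j ≡ true → i ≢ j → adj i j ≡ true

IsClique⇒isClique : ∀ {n} (adj : Adj n) (S : Subset n) → IsClique adj S → isClique adj S ≡ true
IsClique⇒isClique {n} adj S clique =
  ≡0⇒≡ᵇ0 (countFin≡0 n _ (λ i → cong not (≡0⇒≡ᵇ0 (countFin≡0 n _ (no-bad-pair i)))))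
  where
  no-bad-pair : ∀ i j → (lookup S i ∧ lookup S j ∧ not ⌊ i ≟ j ⌋ ∧ not (adj i j)) ≡ false
  no-bad-pair i j with lookup S i in i∈S | lookup S j in j∈S | i ≟ j
  ... | false | _     | _       = refl
  ... | true  | false | _       = refl
  ... | true  | true  | yes _   = refl
  ... | true  | true  | no i≢j rewrite clique i j i∈S j∈S i≢j = refl

isClique⇒IsClique : ∀ {n} (adj : Adj n) (S : Subset n) → isClique adj S ≡ true → IsClique adj S
isClique⇒IsClique {n} adj S clique i j i∈S j∈S i≢j = adjacent _ _ _ _ i∈S j∈S (≟-≢ i≢j) not-bad
  where
  no-bad-partner : countFin n (λ j → lookup S i ∧ lookup S j ∧ not ⌊ i ≟ j ⌋ ∧ not (adj i j)) ≡ 0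
  no-bad-partner = ≡ᵇ0⇒≡0 (not-false (countFin≡0⇒false n _ (≡ᵇ0⇒≡0 clique) i))
    where not-false : ∀ {b} → not b ≡ false → b ≡ true
          not-false {true} _ = refl
  not-bad : (lookup S i ∧ lookup S j ∧ not ⌊ i ≟ j ⌋ ∧ not (adj i j)) ≡ false
  not-bad = countFin≡0⇒false n _ no-bad-partner j
  adjacent : ∀ a b c d → a ≡ true → b ≡ true → c ≡ false → (a ∧ b ∧ not c ∧ not d) ≡ false → d ≡ true
  adjacent true true false true  _ _ _ _ = refl
  adjacent true true false false _ _ _ ()

size-tabulate : ∀ n (f : Fin n → Bool) → size (tabulate f) ≡ countFin n f
size-tabulate zero    f = refl
size-tabulate (suc n) f with f zero
... | true  = cong suc (size-tabulate n (λ i → f (suc i)))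
... | false = size-tabulate n (λ i → f (suc i))

_⊆ᵇ_ : ∀ {n} → Subset n → (Fin n → Bool) → Bool
[]      ⊆ᵇ m = true
(x ∷ S) ⊆ᵇ m = (not x ∨ m zero) ∧ (S ⊆ᵇ λ j → m (suc j))

_⊆_ : ∀ {n} → Subset n → (Fin n → Bool) → Set
S ⊆ m = ∀ j → lookup S j ≡ true → m j ≡ true

⊆⇒⊆ᵇ : ∀ {n} (S : Subset n) m → S ⊆ m → (S ⊆ᵇ m) ≡ true
⊆⇒⊆ᵇ []          m S⊆m = refl
⊆⇒⊆ᵇ (true ∷ S)  m S⊆m = ∧-intro (S⊆m zero refl) (⊆⇒⊆ᵇ S _ (λ j → S⊆m (suc j)))
⊆⇒⊆ᵇ (false ∷ S) m S⊆m = ⊆⇒⊆ᵇ S _ (λ j → S⊆m (suc j))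

⊆ᵇ⇒⊆ : ∀ {n} (S : Subset n) m → (S ⊆ᵇ m) ≡ true → S ⊆ m
⊆ᵇ⇒⊆ (true ∷ S)  m S⊆m zero    _   = ∧-elimˡ (m zero) S⊆m
⊆ᵇ⇒⊆ (true ∷ S)  m S⊆m (suc j) j∈S = ⊆ᵇ⇒⊆ S _ (∧-elimʳ (m zero) S⊆m) j j∈S
⊆ᵇ⇒⊆ (false ∷ S) m S⊆m (suc j) j∈S = ⊆ᵇ⇒⊆ S _ S⊆m j j∈S

⊆ᵇ-∧ : ∀ {n} (S : Subset n) a b → ((S ⊆ᵇ a) ∧ (S ⊆ᵇ b)) ≡ (S ⊆ᵇ λ j → a j ∧ b j)
⊆ᵇ-∧ []          a b = refl
⊆ᵇ-∧ (true ∷ S)  a b with a zero | b zero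
... | true  | true  = ⊆ᵇ-∧ S _ _
... | true  | false = Bool.∧-zeroʳ _
... | false | _     = refl
⊆ᵇ-∧ (false ∷ S) a b = ⊆ᵇ-∧ S _ _

isClique-false∷ : ∀ {n} (adj : Adj (suc n)) (S : Subset n) → isClique adj (false ∷ S) ≡ isClique (tailAdj adj) S
isClique-false∷ adj S = Bool-ext
  (λ clique → IsClique⇒isClique (tailAdj adj) S λ i j i∈S j∈S i≢j →
     isClique⇒IsClique adj (false ∷ S) clique (suc i) (suc j) i∈S j∈S (λ e → i≢j (Fin-suc-injective e)))
  (λ clique → IsClique⇒isClique adj (false ∷ S) λ { (suc i) (suc j) i∈S j∈S i≢j →
     isClique⇒IsClique (tailAdj adj) S clique i j i∈S j∈S (λ e → i≢j (cong suc e)) })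

isClique-true∷ : ∀ {n} (adj : Adj (suc n)) → Symmetric adj → (S : Subset n) →
  isClique adj (true ∷ S) ≡ (isClique (tailAdj adj) S ∧ (S ⊆ᵇ λ j → adj zero (suc j)))
isClique-true∷ adj sym-adj S = Bool-ext
  (λ clique → ∧-intro
     (IsClique⇒isClique (tailAdj adj) S λ i j i∈S j∈S i≢j →
        isClique⇒IsClique adj (true ∷ S) clique (suc i) (suc j) i∈S j∈S (λ e → i≢j (Fin-suc-injective e)))
     (⊆⇒⊆ᵇ S _ λ j j∈S → isClique⇒IsClique adj (true ∷ S) clique zero (suc j) refl j∈S (λ ())))
  (λ h → IsClique⇒isClique adj (true ∷ S) λ
     { zero    zero    _   _   0≢0 → ⊥-elim (0≢0 refl)
     ; zero    (suc j) _   j∈S _   → ⊆ᵇ⇒⊆ S _ (∧-elimʳ (isClique (tailAdj adj) S) h) j j∈S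
     ; (suc i) zero    i∈S _   _   → trans (sym-adj (suc i) zero) (⊆ᵇ⇒⊆ S _ (∧-elimʳ (isClique (tailAdj adj) S) h) i i∈S)
     ; (suc i) (suc j) i∈S j∈S i≢j → isClique⇒IsClique (tailAdj adj) S (∧-elimˡ (isClique (tailAdj adj) S) h) i j i∈S j∈S
                                       (λ e → i≢j (cong suc e)) })

CliqueNumber≤ : ∀ {n} → Adj n → ℕ → Set
CliqueNumber≤ {n} adj ω = ∀ S → isClique adj S ≡ true → size S ≤ ω

SupportIsClique : ∀ {n} → Adj n → Weights n → Set
SupportIsClique adj w = ∀ i j → 0 < w i → 0 < w j → i ≢ j → adj i j ≡ true

-- Weighted clique sums

-- The sum over all s-cliques S of ∏_{v ∈ S} w v, by recursion on the first vertex.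
cliqueSum : ∀ n → Adj n → Weights n → ℕ → ℕ
cliqueSum n       adj w zero    = 1
cliqueSum zero    adj w (suc s) = 0
cliqueSum (suc n) adj w (suc s) =
  cliqueSum n (tailAdj adj) (λ i → w (suc i)) (suc s)
  + w zero * cliqueSum n (tailAdj adj) (restrict (λ i → adj zero (suc i)) (λ i → w (suc i))) s

cliqueSum-cong : ∀ n {adj adj′ : Adj n} {w w′ : Weights n} →
  (∀ i j → adj i j ≡ adj′ i j) → (∀ i → w i ≡ w′ i) → ∀ s → cliqueSum n adj w s ≡ cliqueSum n adj′ w′ s
cliqueSum-cong n       adj≡ w≡ zero    = refl
cliqueSum-cong zero    adj≡ w≡ (suc s) = refl
cliqueSum-cong (suc n) adj≡ w≡ (suc s) = cong₂ _+_
  (cliqueSum-cong n (λ i j → adj≡ (suc i) (suc j)) (λ i → w≡ (suc i)) (suc s))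
  (cong₂ _*_ (w≡ zero) (cliqueSum-cong n (λ i j → adj≡ (suc i) (suc j))
     (λ i → cong₂ (λ b x → if b then x else 0) (adj≡ zero (suc i)) (w≡ (suc i))) s))

cliqueSum-congʷ : ∀ n (adj : Adj n) {w w′ : Weights n} → (∀ i → w i ≡ w′ i) → ∀ s → cliqueSum n adj w s ≡ cliqueSum n adj w′ s
cliqueSum-congʷ n adj = cliqueSum-cong n (λ _ _ → refl)

cliqueSum-mono : ∀ n (adj : Adj n) {w w′ : Weights n} → (∀ i → w i ≤ w′ i) → ∀ s → cliqueSum n adj w s ≤ cliqueSum n adj w′ s
cliqueSum-mono n       adj w≤ zero    = ≤-refl
cliqueSum-mono zero    adj w≤ (suc s) = ≤-refl
cliqueSum-mono (suc n) adj w≤ (suc s) = +-mono-≤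
  (cliqueSum-mono n (tailAdj adj) (λ i → w≤ (suc i)) (suc s))
  (*-mono-≤ (w≤ zero) (cliqueSum-mono n (tailAdj adj) (restrict-mono _ (λ i → w≤ (suc i))) s))

cliqueSum-restrict-head : ∀ n (adj : Adj (suc n)) → adj zero zero ≡ false → (w : Weights (suc n)) → ∀ s →
  cliqueSum (suc n) adj (restrict (adj zero) w) s
    ≡ cliqueSum n (tailAdj adj) (restrict (λ i → adj zero (suc i)) (λ i → w (suc i))) s
cliqueSum-restrict-head n adj loopless w zero    = refl
cliqueSum-restrict-head n adj loopless w (suc s) rewrite loopless = +-identityʳ _

module _ {n} (adj : Adj (suc n)) (sym-adj : Symmetric adj) (w : Weights (suc n)) (i : Fin n) (s : ℕ) where
  private
    w′ : Weights n
    w′ j = w (suc j)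
    N₀ : Fin n → Bool
    N₀ j = adj zero (suc j)

  -- Both sides count the cliques through vertex 0 and vertex i+1 in two orders.
  cliqueSum-head-swap :
    w zero * (restrict N₀ w′ i * cliqueSum n (tailAdj adj) (restrict (tailAdj adj i) (restrict N₀ w′)) s)
      ≡ w (suc i) * (restrict (adj (suc i)) w zero * cliqueSum n (tailAdj adj) (restrict N₀ (restrict (tailAdj adj i) w′)) s)
  cliqueSum-head-swap
    rewrite cliqueSum-congʷ n (tailAdj adj) (restrict-comm (tailAdj adj i) N₀ w′) s | sym-adj (suc i) zero
    with adj zero (suc i)
  ... | true  = x∙yz≈y∙xz (w zero) (w (suc i)) _
  ... | false = trans (*-zeroʳ (w zero)) (sym (*-zeroʳ (w (suc i))))

cliqueSum-split : ∀ n (adj : Adj n) → Symmetric adj → Irreflexive adj → (w : Weights n) (v : Fin n) (s : ℕ) →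
  cliqueSum n adj w (suc s) ≡ cliqueSum n adj (erase v w) (suc s) + w v * cliqueSum n adj (restrict (adj v) w) s
cliqueSum-split (suc n) adj sym-adj irr w zero s =
  sym (cong₂ _+_ (+-identityʳ _) (cong (w zero *_) (cliqueSum-restrict-head n adj (irr zero) w s)))
cliqueSum-split (suc n) adj sym-adj irr w (suc i) zero = begin
  Q w′ 1 + w zero * 1                            ≡⟨ cong (_+ w zero * 1) (cliqueSum-split n A sym-A irr-A w′ i zero) ⟩
  (Q (erase i w′) 1 + w′ i * 1) + w zero * 1     ≡⟨ exchange (Q (erase i w′) 1) (w′ i * 1) (w zero * 1) ⟩
  (Q (erase i w′) 1 + w zero * 1) + w′ i * 1     ≡⟨ cong (λ x → (x + w zero * 1) + w′ i * 1) (cliqueSum-congʷ n A (λ j → sym (erase-suc i w j)) 1) ⟩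
  (Q (λ j → erase (suc i) w (suc j)) 1 + w zero * 1) + w′ i * 1 ∎
  where
  A = tailAdj adj
  Q = λ w s → cliqueSum n A w s
  w′ : Weights n
  w′ j = w (suc j)
  sym-A = tail-symmetric {adj = adj} sym-adj
  irr-A = tail-irreflexive {adj = adj} irr
  open ≡-Reasoning
  exchange : ∀ a b c → (a + b) + c ≡ (a + c) + b
  exchange = solve-∀
cliqueSum-split (suc n) adj sym-adj irr w (suc i) (suc s) = begin
  Q w′ (2 + s) + w zero * Q (N₀ w′) (suc s)
    ≡⟨ cong₂ _+_ (cliqueSum-split n A sym-A irr-A w′ i (suc s)) (cong (w zero *_) (cliqueSum-split n A sym-A irr-A (N₀ w′) i s)) ⟩
  (Q (erase i w′) (2 + s) + w′ i * Q (Nᵢ w′) (suc s)) + w zero * (Q (erase i (N₀ w′)) (suc s) + N₀ w′ i * Q (Nᵢ (N₀ w′)) s)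
    ≡⟨ regroup (Q (erase i w′) (2 + s)) (w′ i) (Q (Nᵢ w′) (suc s)) (w zero) (Q (erase i (N₀ w′)) (suc s))
               (N₀ w′ i * Q (Nᵢ (N₀ w′)) s) (c₀ * Q (N₀ (Nᵢ w′)) s) (cliqueSum-head-swap adj sym-adj w i s) ⟩
  (Q (erase i w′) (2 + s) + w zero * Q (erase i (N₀ w′)) (suc s)) + w′ i * (Q (Nᵢ w′) (suc s) + c₀ * Q (N₀ (Nᵢ w′)) s)
    ≡⟨ cong₂ (λ x y → (x + w zero * y) + w′ i * (Q (Nᵢ w′) (suc s) + c₀ * Q (N₀ (Nᵢ w′)) s))
         (cliqueSum-congʷ n A (λ j → sym (erase-suc i w j)) (2 + s))
         (cliqueSum-congʷ n A (λ j → trans (erase-restrict-comm i (λ j → adj zero (suc j)) w′ j)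
                                            (cong (λ x → if adj zero (suc j) then x else 0) (sym (erase-suc i w j)))) (suc s)) ⟩
  (Q (λ j → erase (suc i) w (suc j)) (2 + s) + w zero * Q (N₀ (λ j → erase (suc i) w (suc j))) (suc s))
    + w′ i * (Q (Nᵢ w′) (suc s) + c₀ * Q (N₀ (Nᵢ w′)) s) ∎
  where
  A = tailAdj adj
  Q = λ w s → cliqueSum n A w s
  w′ : Weights n
  w′ j = w (suc j)
  N₀ Nᵢ : Weights n → Weights n
  N₀ = restrict (λ j → adj zero (suc j))
  Nᵢ = restrict (A i)
  c₀ = restrict (adj (suc i)) w zero
  sym-A = tail-symmetric {adj = adj} sym-adj
  irr-A = tail-irreflexive {adj = adj} irr
  open ≡-Reasoning
  regroup : ∀ z₁ a x b z₂ e f → b * e ≡ a * f → (z₁ + a * x) + b * (z₂ + e) ≡ (z₁ + b * z₂) + a * (x + f)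
  regroup z₁ a x b z₂ e f be≡af = begin
    (z₁ + a * x) + b * (z₂ + e)         ≡⟨ expand z₁ a x b z₂ e ⟩
    (z₁ + b * z₂) + a * x + b * e       ≡⟨ cong ((z₁ + b * z₂) + a * x +_) be≡af ⟩
    (z₁ + b * z₂) + a * x + a * f       ≡⟨ collect z₁ a x b z₂ f ⟩
    (z₁ + b * z₂) + a * (x + f)         ∎
    where
    expand : ∀ z₁ a x b z₂ e → (z₁ + a * x) + b * (z₂ + e) ≡ (z₁ + b * z₂) + a * x + b * e
    expand = solve-∀
    collect : ∀ z₁ a x b z₂ f → (z₁ + b * z₂) + a * x + a * f ≡ (z₁ + b * z₂) + a * (x + f)
    collect = solve-∀

cliqueSum-handshake : ∀ n (adj : Adj n) → Symmetric adj → Irreflexive adj → (w : Weights n) (s : ℕ) →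
  suc s * cliqueSum n adj w (suc s) ≡ sum (λ v → w v * cliqueSum n adj (restrict (adj v) w) s)
cliqueSum-handshake zero adj sym-adj irr w s = *-zeroʳ (suc s)
cliqueSum-handshake (suc n) adj sym-adj irr w zero = begin
  1 * (Q w′ 1 + w zero * 1)                ≡⟨ *-identityˡ _ ⟩
  Q w′ 1 + w zero * 1                      ≡⟨ +-comm (Q w′ 1) _ ⟩
  w zero * 1 + Q w′ 1                      ≡⟨ cong (w zero * 1 +_) (trans (sym (*-identityˡ _)) (cliqueSum-handshake n A sym-A irr-A w′ zero)) ⟩
  w zero * 1 + sum (λ i → w′ i * 1)        ∎
  where
  A = tailAdj adj
  Q = λ w s → cliqueSum n A w s
  w′ : Weights n
  w′ j = w (suc j)
  sym-A = tail-symmetric {adj = adj} sym-adj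
  irr-A = tail-irreflexive {adj = adj} irr
  open ≡-Reasoning
cliqueSum-handshake (suc n) adj sym-adj irr w (suc s) = sym (begin
  w zero * cliqueSum (suc n) adj (restrict (adj zero) w) (suc s) + sum (λ i → w′ i * (X i + c i * Y′ i))
     ≡⟨ cong₂ _+_ (cong (w zero *_) (cliqueSum-restrict-head n adj (irr zero) w (suc s)))
                  (sum-cong-≗ (λ i → *-distribˡ-+ (w′ i) (X i) _)) ⟩
  w zero * Q₂ + sum (λ i → w′ i * X i + w′ i * (c i * Y′ i))
     ≡⟨ cong (w zero * Q₂ +_) (∑-distrib-+ (λ i → w′ i * X i) (λ i → w′ i * (c i * Y′ i))) ⟩
  w zero * Q₂ + (sum (λ i → w′ i * X i) + sum (λ i → w′ i * (c i * Y′ i)))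
     ≡⟨ cong (λ z → w zero * Q₂ + (sum (λ i → w′ i * X i) + z)) (sum-cong-≗ (λ i → sym (cliqueSum-head-swap adj sym-adj w i s))) ⟩
  w zero * Q₂ + (sum (λ i → w′ i * X i) + sum (λ i → w zero * (N₀ w′ i * Y i)))
     ≡⟨ cong (λ z → w zero * Q₂ + (sum (λ i → w′ i * X i) + z)) (sym (*-distribˡ-sum (w zero) (λ i → N₀ w′ i * Y i))) ⟩
  w zero * Q₂ + (sum (λ i → w′ i * X i) + w zero * sum (λ i → N₀ w′ i * Y i))
     ≡⟨ cong₂ (λ a b → w zero * Q₂ + (a + w zero * b))
              (sym (cliqueSum-handshake n A sym-A irr-A w′ (suc s))) (sym (cliqueSum-handshake n A sym-A irr-A (N₀ w′) s)) ⟩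
  w zero * Q₂ + (suc (suc s) * Q₁ + w zero * (suc s * Q₂))  ≡⟨ collect (w zero) Q₁ Q₂ s ⟩
  suc (suc s) * (Q₁ + w zero * Q₂) ∎)
  where
  A = tailAdj adj
  Q = λ w s → cliqueSum n A w s
  w′ : Weights n
  w′ j = w (suc j)
  N₀ : Weights n → Weights n
  N₀ = restrict (λ j → adj zero (suc j))
  sym-A = tail-symmetric {adj = adj} sym-adj
  irr-A = tail-irreflexive {adj = adj} irr
  open ≡-Reasoning
  Q₁ = Q w′ (suc (suc s))
  Q₂ = Q (N₀ w′) (suc s)
  X Y Y′ c : Weights n
  X i  = Q (restrict (A i) w′) (suc s)
  Y i  = Q (restrict (A i) (N₀ w′)) s
  Y′ i = Q (N₀ (restrict (A i) w′)) s
  c i  = restrict (adj (suc i)) w zero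
  collect : ∀ a q₁ q₂ s → a * q₂ + (suc (suc s) * q₁ + a * (suc s * q₂)) ≡ suc (suc s) * (q₁ + a * q₂)
  collect = solve-∀

cliqueSum-one : ∀ m (adj : Adj m) (w : Weights m) → cliqueSum m adj w 1 ≡ sum w
cliqueSum-one zero    adj w = refl
cliqueSum-one (suc m) adj w = trans (+-comm (cliqueSum m (tailAdj adj) (λ i → w (suc i)) 1) _)
  (cong₂ _+_ (*-identityʳ (w zero)) (cliqueSum-one m (tailAdj adj) (λ i → w (suc i))))

cliqueSum-zero-weights : ∀ n (adj : Adj n) (w : Weights n) → (∀ i → w i ≡ 0) → ∀ s → cliqueSum n adj w (suc s) ≡ 0
cliqueSum-zero-weights zero    adj w w≡0 s = refl
cliqueSum-zero-weights (suc n) adj w w≡0 s rewrite w≡0 zero =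
  trans (+-identityʳ _) (cliqueSum-zero-weights n (tailAdj adj) (λ i → w (suc i)) (λ i → w≡0 (suc i)) s)

cliqueSum-too-large : ∀ n (adj : Adj n) (w : Weights n) s → n < s → cliqueSum n adj w s ≡ 0
cliqueSum-too-large zero    adj w (suc s) _         = refl
cliqueSum-too-large (suc n) adj w (suc s) (s≤s n<s) =
  trans (cong₂ _+_ (cliqueSum-too-large n (tailAdj adj) _ (suc s) (m<n⇒m<1+n n<s))
                   (cong (w zero *_) (cliqueSum-too-large n (tailAdj adj) _ s n<s)))
        (*-zeroʳ (w zero))

cliqueSum-supportIsClique : ∀ n (adj : Adj n) (w : Weights n) → SupportIsClique adj w →
  ∀ s → cliqueSum n adj w s ≡ cliqueSum n (completeAdj n) w s
cliqueSum-supportIsClique n       adj w clique zero    = refl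
cliqueSum-supportIsClique zero    adj w clique (suc s) = refl
cliqueSum-supportIsClique (suc n) adj w clique (suc s) = cong₂ _+_ without-0 with-0
  where
  w′ : Weights n
  w′ i = w (suc i)
  clique′ : SupportIsClique (tailAdj adj) w′
  clique′ i j wi>0 wj>0 i≢j = clique (suc i) (suc j) wi>0 wj>0 (λ e → i≢j (Fin-suc-injective e))


  without-0 : cliqueSum n (tailAdj adj) w′ (suc s) ≡ cliqueSum n (tailAdj (completeAdj (suc n))) w′ (suc s)
  without-0 = trans (cliqueSum-supportIsClique n (tailAdj adj) w′ clique′ (suc s))
                    (cliqueSum-cong n (λ i j → sym (completeAdj-tail n i j)) (λ _ → refl) (suc s))
  restrict-neighbours : 0 < w zero → ∀ i → restrict (λ i → adj zero (suc i)) w′ i ≡ w′ i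
  restrict-neighbours w₀>0 i with w′ i in wi≡
  ... | zero  = Bool.if-eta (adj zero (suc i))
  ... | suc x = cong (λ b → if b then suc x else 0) (clique zero (suc i) w₀>0 (subst (0 <_) (sym wi≡) (s≤s z≤n)) (λ ()))
  with-0 : w zero * cliqueSum n (tailAdj adj) (restrict (λ i → adj zero (suc i)) w′) s
             ≡ w zero * cliqueSum n (tailAdj (completeAdj (suc n))) (restrict (λ i → completeAdj (suc n) zero (suc i)) w′) s
  with-0 with w zero in w₀≡
  ... | zero  = refl
  ... | suc x = cong (suc x *_) (trans (cliqueSum-congʷ n (tailAdj adj) (restrict-neighbours (subst (0 <_) (sym w₀≡) (s≤s z≤n))) s)
                  (trans (cliqueSum-supportIsClique n (tailAdj adj) w′ clique′ s)
                         (cliqueSum-cong n (λ i j → sym (completeAdj-tail n i j)) (λ _ → refl) s)))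

cliqueSum-complete-const : ∀ m (A : Fin m → Bool) b s →
  cliqueSum m (completeAdj m) (restrict A (λ _ → b)) s ≡ binomial (countFin m A) s * b ^ s
cliqueSum-complete-const m       A b zero    = refl
cliqueSum-complete-const zero    A b (suc s) = refl
cliqueSum-complete-const (suc m) A b (suc s) = begin
  Q (suc s) + restrict A (λ _ → b) zero * Q s
    ≡⟨ cong₂ (λ x y → x + restrict A (λ _ → b) zero * y) (induction (suc s)) (induction s) ⟩
  binomial c (suc s) * b ^ suc s + restrict A (λ _ → b) zero * (binomial c s * b ^ s)
    ≡⟨ Pascal (A zero) ⟩
  binomial (countFin (suc m) A) (suc s) * b ^ suc s ∎
  where
  open ≡-Reasoning
  A′ = λ i → A (suc i)
  c = countFin m A′
  Q = cliqueSum m (tailAdj (completeAdj (suc m))) (restrict A′ (λ _ → b))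
  induction : ∀ s → Q s ≡ binomial c s * b ^ s
  induction s = trans (cliqueSum-cong m (completeAdj-tail m) (λ _ → refl) s) (cliqueSum-complete-const m A′ b s)
  Pascal : ∀ a → binomial c (suc s) * b ^ suc s + (if a then b else 0) * (binomial c s * b ^ s)
                   ≡ binomial (𝟙 a + c) (suc s) * b ^ suc s
  Pascal true  = regroup (binomial c (suc s)) (binomial c s) b (b ^ s)
    where regroup : ∀ x y b z → x * (b * z) + b * (y * z) ≡ (y + x) * (b * z)
          regroup = solve-∀
  Pascal false = +-identityʳ _

cliqueSum-complete-pair : ∀ m (w : Weights m) i j → i ≢ j → ∀ s →
  let K = completeAdj m ; Z = erase i (erase j w) in
  cliqueSum m K w (2 + s) ≡ cliqueSum m K Z (2 + s) + (w i + w j) * cliqueSum m K Z (suc s) + (w i * w j) * cliqueSum m K Z s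
cliqueSum-complete-pair m w i j i≢j s = begin
  Q w (2 + s)
    ≡⟨ split w j (suc s) ⟩
  Q (erase j w) (2 + s) + w j * Q (restrict (K j) w) (suc s)
    ≡⟨ cong₂ (λ x y → x + w j * y) (split (erase j w) i (suc s)) (split (restrict (K j) w) i s) ⟩
  (Q Z (2 + s) + erase j w i * Q (restrict (K i) (erase j w)) (suc s))
    + w j * (Q (erase i (restrict (K j) w)) (suc s) + restrict (K j) w i * Q (restrict (K i) (restrict (K j) w)) s)
    ≡⟨ cong₂ (λ x y → (Q Z (2 + s) + x * Q (restrict (K i) (erase j w)) (suc s))
                     + w j * (Q (erase i (restrict (K j) w)) (suc s) + y * Q (restrict (K i) (restrict (K j) w)) s))
             (erase-other w i≢j) (trans (restrict-completeAdj m j w i) (erase-other w i≢j)) ⟩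
  (Q Z (2 + s) + w i * Q (restrict (K i) (erase j w)) (suc s))
    + w j * (Q (erase i (restrict (K j) w)) (suc s) + w i * Q (restrict (K i) (restrict (K j) w)) s)
    ≡⟨ cong₂ (λ x y → (Q Z (2 + s) + w i * x) + w j * (y + w i * Q (restrict (K i) (restrict (K j) w)) s)) near-i near-j ⟩
  (Q Z (2 + s) + w i * Q Z (suc s)) + w j * (Q Z (suc s) + w i * Q (restrict (K i) (restrict (K j) w)) s)
    ≡⟨ cong (λ z → (Q Z (2 + s) + w i * Q Z (suc s)) + w j * (Q Z (suc s) + w i * z)) near-both ⟩
  (Q Z (2 + s) + w i * Q Z (suc s)) + w j * (Q Z (suc s) + w i * Q Z s)
    ≡⟨ collect (Q Z (2 + s)) (w i) (w j) (Q Z (suc s)) (Q Z s) ⟩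
  Q Z (2 + s) + (w i + w j) * Q Z (suc s) + (w i * w j) * Q Z s ∎
  where
  open ≡-Reasoning
  K = completeAdj m
  Z = erase i (erase j w)
  Q = cliqueSum m K
  split = cliqueSum-split m K (completeAdj-symmetric m) (completeAdj-irreflexive m)
  erase-i-restrict : ∀ {w′} → (∀ k → restrict (K j) w k ≡ w′ k) → ∀ k → erase i (restrict (K j) w) k ≡ erase i w′ k
  erase-i-restrict eq k = cong (λ z → if ⌊ k ≟ i ⌋ then 0 else z) (eq k)
  near-i : Q (restrict (K i) (erase j w)) (suc s) ≡ Q Z (suc s)
  near-i = cliqueSum-congʷ m K (restrict-completeAdj m i (erase j w)) (suc s)
  near-j : Q (erase i (restrict (K j) w)) (suc s) ≡ Q Z (suc s)
  near-j = cliqueSum-congʷ m K (erase-i-restrict (restrict-completeAdj m j w)) (suc s)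
  near-both : Q (restrict (K i) (restrict (K j) w)) s ≡ Q Z s
  near-both = cliqueSum-congʷ m K (λ k → trans (restrict-completeAdj m i (restrict (K j) w) k)
                                               (erase-i-restrict (restrict-completeAdj m j w) k)) s
  collect : ∀ a x y b c → (a + x * b) + y * (b + x * c) ≡ a + (x + y) * b + (x * y) * c
  collect = solve-∀

-- Zero-weight vertices, giving the complete graph the r vertices the balancing argument needs.
padZeros : ∀ r {n} → Weights n → Weights (r + n)
padZeros zero    w         = w
padZeros (suc r) w zero    = 0
padZeros (suc r) w (suc i) = padZeros r w i

cliqueSum-padZeros : ∀ r n (w : Weights n) s → cliqueSum n (completeAdj n) w s ≡ cliqueSum (r + n) (completeAdj (r + n)) (padZeros r w) s
cliqueSum-padZeros zero    n w s       = refl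
cliqueSum-padZeros (suc r) n w zero    = refl
cliqueSum-padZeros (suc r) n w (suc s) = trans (cliqueSum-padZeros r n w (suc s))
  (trans (sym (cliqueSum-cong (r + n) (completeAdj-tail (r + n)) (λ _ → refl) (suc s))) (sym (+-identityʳ _)))

sum-padZeros : ∀ r {n} (w : Weights n) → sum (padZeros r w) ≡ sum w
sum-padZeros zero    w = refl
sum-padZeros (suc r) w = sum-padZeros r w

supportSize-padZeros : ∀ r {n} (w : Weights n) → supportSize (padZeros r w) ≡ supportSize w
supportSize-padZeros zero    w = refl
supportSize-padZeros (suc r) w = supportSize-padZeros r w

partWeights : ∀ {n k} → (Fin n → Fin k) → Weights n → Weights k
partWeights {n} c w x = sum (λ i → if ⌊ c i ≟ x ⌋ then w i else 0)

partWeights-restrict-outside : ∀ {n k} (c : Fin n → Fin k) (m : Fin n → Bool) (w : Weights n) x₀ →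
  (∀ i → m i ≡ not ⌊ x₀ ≟ c i ⌋) → ∀ x → partWeights c (restrict m w) x ≡ erase x₀ (partWeights c w) x
partWeights-restrict-outside {n} c m w x₀ m≡ x with x ≟ x₀
... | yes refl = trans (sum-cong-≗ inside) (trans (sum-const n 0) (*-zeroʳ n))
  where
  inside : ∀ i → (if ⌊ c i ≟ x₀ ⌋ then restrict m w i else 0) ≡ 0
  inside i with c i ≟ x₀
  ... | no  _      = refl
  ... | yes ci≡x₀ = cong (λ b → if b then w i else 0) (trans (m≡ i) (cong not (trans (cong (λ z → ⌊ x₀ ≟ z ⌋) ci≡x₀) (≟-refl x₀))))
... | no x≢x₀ = sum-cong-≗ outside
  where
  outside : ∀ i → (if ⌊ c i ≟ x ⌋ then restrict m w i else 0) ≡ (if ⌊ c i ≟ x ⌋ then w i else 0)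
  outside i with c i ≟ x
  ... | no  _    = refl
  ... | yes ci≡x = cong (λ b → if b then w i else 0) (trans (m≡ i) (cong not (≟-≢ (λ x₀≡ci → x≢x₀ (sym (trans x₀≡ci ci≡x))))))

cliqueSum-blowup : ∀ n k (adj : Adj n) (c : Fin n → Fin k) → (∀ i j → adj i j ≡ completeAdj k (c i) (c j)) →
  ∀ w s → cliqueSum n adj w s ≡ cliqueSum k (completeAdj k) (partWeights c w) s
cliqueSum-blowup n       k adj c adj≡ w zero    = refl
cliqueSum-blowup zero    k adj c adj≡ w (suc s) = sym (cliqueSum-zero-weights k (completeAdj k) _ (λ _ → refl) s)
cliqueSum-blowup (suc n) k adj c adj≡ w (suc s) = begin
  Q′ w′ (suc s) + w zero * Q′ (restrict N₀ w′) s
    ≡⟨ cong₂ (λ x y → x + w zero * y) (induction w′ (suc s)) (trans (induction (restrict N₀ w′) s) (cliqueSum-congʷ k K other-parts s)) ⟩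
  Q p′ (suc s) + w zero * Q (erase c₀ p′) s
    ≡⟨ cong (_+ w zero * Q (erase c₀ p′) s) (cliqueSum-split k K (completeAdj-symmetric k) (completeAdj-irreflexive k) p′ c₀ s) ⟩
  (Q (erase c₀ p′) (suc s) + p′ c₀ * Q (restrict (K c₀) p′) s) + w zero * Q (erase c₀ p′) s
    ≡⟨ cong (λ z → (Q (erase c₀ p′) (suc s) + p′ c₀ * z) + w zero * Q (erase c₀ p′) s) (cliqueSum-congʷ k K (restrict-completeAdj k c₀ p′) s) ⟩
  (Q (erase c₀ p′) (suc s) + p′ c₀ * Y) + w zero * Y                 ≡⟨ collect (Q (erase c₀ p′) (suc s)) (p′ c₀) (w zero) Y ⟩
  Q (erase c₀ p′) (suc s) + (w zero + p′ c₀) * Y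
    ≡⟨ cong (λ y → Q (erase c₀ p′) (suc s) + y * Y) (cong (_+ p′ c₀) (sym (cong (λ b → if b then w zero else 0) (≟-refl c₀)))) ⟩
  Q (erase c₀ p′) (suc s) + p c₀ * Y
    ≡⟨ cong₂ (λ x y → x + p c₀ * y) (cliqueSum-congʷ k K same-erased (suc s))
             (cliqueSum-congʷ k K (λ x → trans (same-erased x) (sym (restrict-completeAdj k c₀ p x))) s) ⟩
  Q (erase c₀ p) (suc s) + p c₀ * Q (restrict (K c₀) p) s
    ≡⟨ cliqueSum-split k K (completeAdj-symmetric k) (completeAdj-irreflexive k) p c₀ s ⟨
  Q p (suc s) ∎
  where
  open ≡-Reasoning
  K = completeAdj k
  Q = cliqueSum k K
  Q′ = cliqueSum n (tailAdj adj)
  w′ : Weights n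
  w′ i = w (suc i)
  c′ : Fin n → Fin k
  c′ i = c (suc i)
  c₀ = c zero
  N₀ : Fin n → Bool
  N₀ j = adj zero (suc j)
  induction = cliqueSum-blowup n k (tailAdj adj) c′ (λ i j → adj≡ (suc i) (suc j))
  p′ = partWeights c′ w′
  p  = partWeights c w
  Y = Q (erase c₀ p′) s
  collect : ∀ z a b y → (z + a * y) + b * y ≡ z + (b + a) * y
  collect = solve-∀
  other-parts : ∀ x → partWeights c′ (restrict N₀ w′) x ≡ erase c₀ p′ x
  other-parts = partWeights-restrict-outside c′ N₀ w′ c₀ (λ i → adj≡ zero (suc i))
  same-erased : ∀ x → erase c₀ p′ x ≡ erase c₀ p x
  same-erased x with x ≟ c₀
  ... | yes _    = refl
  ... | no x≢c₀ = cong (λ b → (if b then w zero else 0) + p′ x) (sym (≟-≢ (λ c₀≡x → x≢c₀ (sym c₀≡x))))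

cliquesWithin : ∀ {n} → Adj n → ℕ → (Fin n → Bool) → ℕ
cliquesWithin {n} adj s m = countList (λ S → isClique adj S ∧ (size S ≡ᵇ s) ∧ (S ⊆ᵇ m)) (allSubsets n)

cliquesWithin-through-head : ∀ {n} (adj : Adj (suc n)) → Symmetric adj → ∀ s (m : Fin n → Bool) →
  countList (λ S → isClique adj (true ∷ S) ∧ (size S ≡ᵇ s) ∧ (S ⊆ᵇ m)) (allSubsets n)
    ≡ cliquesWithin (tailAdj adj) s (λ j → adj zero (suc j) ∧ m j)
cliquesWithin-through-head adj sym-adj s m = countList-cong (λ S →
  trans (cong (λ z → z ∧ (size S ≡ᵇ s) ∧ (S ⊆ᵇ m)) (isClique-true∷ adj sym-adj S))
        (trans (regroup (isClique (tailAdj adj) S) (S ⊆ᵇ λ j → adj zero (suc j)) (size S ≡ᵇ s) (S ⊆ᵇ m))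
               (cong (λ z → isClique (tailAdj adj) S ∧ (size S ≡ᵇ s) ∧ z) (⊆ᵇ-∧ S (λ j → adj zero (suc j)) m)))) (allSubsets _)
  where
  regroup : ∀ c x y z → ((c ∧ x) ∧ y ∧ z) ≡ (c ∧ y ∧ (x ∧ z))
  regroup true  true  y     z = refl
  regroup true  false true  z = refl
  regroup true  false false z = refl
  regroup false x     y     z = refl

cliquesWithin≡cliqueSum : ∀ n (adj : Adj n) → Symmetric adj → ∀ (m : Fin n → Bool) s →
  cliquesWithin adj s m ≡ cliqueSum n adj (λ i → 𝟙 (m i)) s
cliquesWithin≡cliqueSum zero    adj sym-adj m zero    = refl
cliquesWithin≡cliqueSum zero    adj sym-adj m (suc s) = refl
cliquesWithin≡cliqueSum (suc n) adj sym-adj m s = begin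
  cliquesWithin adj s m                                            ≡⟨ countList-allSubsets-suc n _ ⟩
  countList (λ S → P (false ∷ S)) A + countList (λ S → P (true ∷ S)) A
    ≡⟨ cong (_+ countList (λ S → P (true ∷ S)) A) avoiding-0 ⟩
  cliqueSum n (tailAdj adj) (λ i → 𝟙 (m′ i)) s + countList (λ S → P (true ∷ S)) A
    ≡⟨ through-0 s ⟩
  cliqueSum (suc n) adj (λ i → 𝟙 (m i)) s                          ∎
  where
  open ≡-Reasoning
  A = allSubsets n
  P : Subset (suc n) → Bool
  P S = isClique adj S ∧ (size S ≡ᵇ s) ∧ (S ⊆ᵇ m)
  m′ N₀ : Fin n → Bool
  m′ j = m (suc j)
  N₀ j = adj zero (suc j)
  induction = cliquesWithin≡cliqueSum n (tailAdj adj) (tail-symmetric {adj = adj} sym-adj)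
  avoiding-0 : countList (λ S → P (false ∷ S)) A ≡ cliqueSum n (tailAdj adj) (λ i → 𝟙 (m′ i)) s
  avoiding-0 = trans (countList-cong (λ S → cong (λ z → z ∧ (size S ≡ᵇ s) ∧ (S ⊆ᵇ m′)) (isClique-false∷ adj S)) A) (induction m′ s)
  through-0 : ∀ s → cliqueSum n (tailAdj adj) (λ i → 𝟙 (m′ i)) s
                      + countList (λ S → isClique adj (true ∷ S) ∧ (size (true ∷ S) ≡ᵇ s) ∧ ((true ∷ S) ⊆ᵇ m)) A
                    ≡ cliqueSum (suc n) adj (λ i → 𝟙 (m i)) s
  through-0 zero     = cong (1 +_) (countList-≡0 _ (λ S → Bool.∧-zeroʳ _) A)
  through-0 (suc s′) = cong (cliqueSum n (tailAdj adj) (λ i → 𝟙 (m′ i)) (suc s′) +_) (by-head (m zero) refl)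
    where
    𝟙-∧ : ∀ a b → (if a then 𝟙 b else 0) ≡ 𝟙 (a ∧ b)
    𝟙-∧ true  b = refl
    𝟙-∧ false b = refl
    by-head : ∀ b → m zero ≡ b →
      countList (λ S → isClique adj (true ∷ S) ∧ (size S ≡ᵇ s′) ∧ ((false ∨ m zero) ∧ (S ⊆ᵇ m′))) A
        ≡ 𝟙 (m zero) * cliqueSum n (tailAdj adj) (restrict N₀ (λ i → 𝟙 (m′ i))) s′
    by-head false m₀≡ rewrite m₀≡ =
      countList-≡0 _ (λ S → trans (cong (isClique adj (true ∷ S) ∧_) (Bool.∧-zeroʳ _)) (Bool.∧-zeroʳ _)) A
    by-head true  m₀≡ rewrite m₀≡ = begin
      countList (λ S → isClique adj (true ∷ S) ∧ (size S ≡ᵇ s′) ∧ (S ⊆ᵇ m′)) A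
                                                                  ≡⟨ cliquesWithin-through-head adj sym-adj s′ m′ ⟩
      cliquesWithin (tailAdj adj) s′ (λ j → N₀ j ∧ m′ j)          ≡⟨ induction (λ j → N₀ j ∧ m′ j) s′ ⟩
      cliqueSum n (tailAdj adj) (λ j → 𝟙 (N₀ j ∧ m′ j)) s′          ≡⟨ cliqueSum-congʷ n (tailAdj adj) (λ j → sym (𝟙-∧ (N₀ j) (m′ j))) s′ ⟩
      cliqueSum n (tailAdj adj) (restrict N₀ (λ i → 𝟙 (m′ i))) s′     ≡⟨ +-identityʳ _ ⟨
      1 * cliqueSum n (tailAdj adj) (restrict N₀ (λ i → 𝟙 (m′ i))) s′ ∎

kt≡cliqueSum : ∀ n (adj : Adj n) → Symmetric adj → ∀ t → kt t adj ≡ cliqueSum n adj (λ _ → 1) t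
kt≡cliqueSum n adj sym-adj t = trans
  (countList-cong (λ S → sym (trans (cong (λ z → isClique adj S ∧ (size S ≡ᵇ t) ∧ z) (⊆⇒⊆ᵇ S _ (λ _ _ → refl)))
                                    (cong (isClique adj S ∧_) (Bool.∧-identityʳ _)))) (allSubsets n))
  (cliquesWithin≡cliqueSum n adj sym-adj (λ _ → true) t)

-- Symmetrization and balancing: the upper bound

module Symmetrization {n} (adj : Adj n) (sym-adj : Symmetric adj) (irr : Irreflexive adj) (s : ℕ) where

  record Improvement (w w′ : Weights n) : Set where
    field
      total-≡    : sum w′ ≡ sum w
      support-⊆  : ∀ i → 0 < w′ i → 0 < w i
      cliqueSum-≤ : cliqueSum n adj w (suc s) ≤ cliqueSum n adj w′ (suc s)

  open Improvement public

  improvement-refl : ∀ {w} → Improvement w w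
  improvement-refl = record { total-≡ = refl ; support-⊆ = λ _ p → p ; cliqueSum-≤ = ≤-refl }

  improvement-trans : ∀ {w₁ w₂ w₃} → Improvement w₁ w₂ → Improvement w₂ w₃ → Improvement w₁ w₃
  improvement-trans i₁₂ i₂₃ = record
    { total-≡     = trans (total-≡ i₂₃) (total-≡ i₁₂)
    ; support-⊆   = λ i p → support-⊆ i₁₂ i (support-⊆ i₂₃ i p)
    ; cliqueSum-≤ = ≤-trans (cliqueSum-≤ i₁₂) (cliqueSum-≤ i₂₃)
    }

  -- Moving all weight of v onto a non-neighbour u at least as good as v: the
  -- clique sum is affine in (w u, w v) with coefficients Cᵤ ≥ Cᵥ, since no clique uses both.
  module Merge (w : Weights n) (u v : Fin n) (u≢v : u ≢ v) (uv∉E : adj u v ≡ false) (wu>0 : 0 < w u) (wv>0 : 0 < w v)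
               (Cᵥ≤Cᵤ : cliqueSum n adj (restrict (adj v) w) s ≤ cliqueSum n adj (restrict (adj u) w) s) where

    merged : Weights n
    merged = update (erase v w) u (w u + w v)

    private
      v≢u : v ≢ u
      v≢u v≡u = u≢v (sym v≡u)

      merged-u : merged u ≡ w u + w v
      merged-u = update-self (erase v w) u (w u + w v)

      merged-v : merged v ≡ 0
      merged-v = trans (update-other (erase v w) (w u + w v) v≢u) (erase-self w v)

      merged-other : ∀ {i} → i ≢ u → i ≢ v → merged i ≡ w i
      merged-other i≢u i≢v = trans (update-other (erase v w) (w u + w v) i≢u) (erase-other w i≢v)

      neighbour-of-u : ∀ i → adj u i ≡ true → i ≢ u × i ≢ v
      neighbour-of-u i ui∈E = (λ { refl → true≢false (trans (sym ui∈E) (irr u)) })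
                            , (λ { refl → true≢false (trans (sym ui∈E) uv∉E) })

    total : sum merged ≡ sum w
    total = +-cancelˡ-≡ (w u) _ _ (begin
      w u + sum merged                   ≡⟨ +-comm (w u) _ ⟩
      sum merged + w u                   ≡⟨ cong (sum merged +_) (erase-other w u≢v) ⟨
      sum merged + erase v w u           ≡⟨ sum-update (erase v w) u (w u + w v) ⟩
      sum (erase v w) + (w u + w v)      ≡⟨ cong (sum (erase v w) +_) (+-comm (w u) (w v)) ⟩
      sum (erase v w) + (w v + w u)      ≡⟨ +-assoc (sum (erase v w)) _ _ ⟨
      sum (erase v w) + w v + w u        ≡⟨ cong (_+ w u) (trans (sum-update w v 0) (+-identityʳ _)) ⟩
      sum w + w u                        ≡⟨ +-comm _ (w u) ⟩
      w u + sum w                        ∎)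
      where open ≡-Reasoning

    support : ∀ i → 0 < merged i → 0 < w i
    support i merged>0 = by-cases (i ≟ u) (i ≟ v)
      where
      by-cases : Dec (i ≡ u) → Dec (i ≡ v) → 0 < w i
      by-cases (yes i≡u) _          = subst (λ k → 0 < w k) (sym i≡u) wu>0
      by-cases (no i≢u)  (yes i≡v)  = ⊥-elim (<-irrefl (sym (subst (λ k → merged k ≡ 0) (sym i≡v) merged-v)) merged>0)
      by-cases (no i≢u)  (no i≢v)   = subst (0 <_) (merged-other i≢u i≢v) merged>0

    supportSize-< : supportSize merged < supportSize w
    supportSize-< = sum-mono-< (λ i → 𝟙-positive-mono (merged i) (w i) (support i)) v
      (subst (λ z → 𝟙 (positive z) < 𝟙 (positive (w v))) (sym merged-v)
        (subst (λ b → 0 < 𝟙 b) (sym (positive-true wv>0)) (s≤s z≤n)))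

    private
      both-erased : ∀ i → erase u (erase v merged) i ≡ erase u (erase v w) i
      both-erased i = by-cases (i ≟ u) (i ≟ v)
        where
        by-cases : Dec (i ≡ u) → Dec (i ≡ v) → erase u (erase v merged) i ≡ erase u (erase v w) i
        by-cases (yes refl) _          = trans (erase-self (erase v merged) u) (sym (erase-self (erase v w) u))
        by-cases (no i≢u)   (yes refl) = trans (erase-other (erase v merged) i≢u)
                                           (trans (erase-self merged v) (sym (trans (erase-other (erase v w) i≢u) (erase-self w v))))
        by-cases (no i≢u)   (no i≢v)   = trans (erase-other (erase v merged) i≢u) (trans (erase-other merged i≢v)
                                           (trans (merged-other i≢u i≢v) (sym (trans (erase-other (erase v w) i≢u) (erase-other w i≢v)))))

      near-u-merged : ∀ i → restrict (adj u) (erase v merged) i ≡ restrict (adj u) w i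
      near-u-merged i = restrict-cong (adj u) {erase v merged} {w} i λ ui∈E →
        let (i≢u , i≢v) = neighbour-of-u i ui∈E in trans (erase-other merged i≢v) (merged-other i≢u i≢v)

      near-u : ∀ i → restrict (adj u) (erase v w) i ≡ restrict (adj u) w i
      near-u i = restrict-cong (adj u) {erase v w} {w} i λ ui∈E → erase-other w (proj₂ (neighbour-of-u i ui∈E))

      Q = λ w s → cliqueSum n adj w s
      A  = Q (erase u (erase v w)) (suc s)
      Cᵤ = Q (restrict (adj u) w) s
      Cᵥ = Q (restrict (adj v) w) s

      expand-w : Q w (suc s) ≡ (A + w u * Cᵤ) + w v * Cᵥ
      expand-w = begin
        Q w (suc s)                                                             ≡⟨ cliqueSum-split n adj sym-adj irr w v s ⟩
        Q (erase v w) (suc s) + w v * Cᵥ                                        ≡⟨ cong (_+ w v * Cᵥ) (cliqueSum-split n adj sym-adj irr (erase v w) u s) ⟩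
        (A + erase v w u * Q (restrict (adj u) (erase v w)) s) + w v * Cᵥ
          ≡⟨ cong₂ (λ a b → (A + a * b) + w v * Cᵥ) (erase-other w u≢v) (cliqueSum-congʷ n adj near-u s) ⟩
        (A + w u * Cᵤ) + w v * Cᵥ                                               ∎
        where open ≡-Reasoning

      expand-merged : Q merged (suc s) ≡ A + (w u + w v) * Cᵤ
      expand-merged = begin
        Q merged (suc s)                             ≡⟨ cliqueSum-split n adj sym-adj irr merged v s ⟩
        Q (erase v merged) (suc s) + merged v * _
          ≡⟨ cong₂ _+_ (cliqueSum-split n adj sym-adj irr (erase v merged) u s) (cong (_* Q (restrict (adj v) merged) s) merged-v) ⟩
        (Q (erase u (erase v merged)) (suc s) + erase v merged u * Q (restrict (adj u) (erase v merged)) s) + 0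
          ≡⟨ +-identityʳ _ ⟩
        Q (erase u (erase v merged)) (suc s) + erase v merged u * Q (restrict (adj u) (erase v merged)) s
          ≡⟨ cong₂ _+_ (cliqueSum-congʷ n adj both-erased (suc s))
                       (cong₂ _*_ (trans (erase-other merged u≢v) merged-u) (cliqueSum-congʷ n adj near-u-merged s)) ⟩
        A + (w u + w v) * Cᵤ                         ∎
        where open ≡-Reasoning

    cliqueSum-≤-merged : Q w (suc s) ≤ Q merged (suc s)
    cliqueSum-≤-merged = begin
      Q w (suc s)                   ≡⟨ expand-w ⟩
      (A + w u * Cᵤ) + w v * Cᵥ     ≤⟨ +-monoʳ-≤ (A + w u * Cᵤ) (*-monoʳ-≤ (w v) Cᵥ≤Cᵤ) ⟩
      (A + w u * Cᵤ) + w v * Cᵤ     ≡⟨ collect A (w u) (w v) Cᵤ ⟩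
      A + (w u + w v) * Cᵤ          ≡⟨ expand-merged ⟨
      Q merged (suc s)              ∎
      where open ≤-Reasoning
            collect : ∀ a x y c → (a + x * c) + y * c ≡ a + (x + y) * c
            collect = solve-∀

    improvement : Improvement w merged
    improvement = record { total-≡ = total ; support-⊆ = support ; cliqueSum-≤ = cliqueSum-≤-merged }

  NonEdgeInSupport : Weights n → Set
  NonEdgeInSupport w = ∃ λ u → ∃ λ v → (0 < w u × 0 < w v) × (u ≢ v × adj u v ≡ false)

  nonEdgeInSupport? : ∀ w → Dec (NonEdgeInSupport w)
  nonEdgeInSupport? w = any? λ u → any? λ v →
    ((0 <? w u) ×-dec (0 <? w v)) ×-dec (¬? (u ≟ v) ×-dec (adj u v Bool.≟ false))

  supportIsClique : ∀ w → ¬ NonEdgeInSupport w → SupportIsClique adj w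
  supportIsClique w no-non-edge i j wi>0 wj>0 i≢j with adj i j in ij∈E
  ... | true  = refl
  ... | false = ⊥-elim (no-non-edge (i , j , (wi>0 , wj>0) , (i≢j , ij∈E)))

  Symmetrized : Weights n → Set
  Symmetrized w = Σ[ w′ ∈ Weights n ] (Improvement w w′ × SupportIsClique adj w′)

  improvement-then : ∀ {w w₁} → Improvement w w₁ → Symmetrized w₁ → Symmetrized w
  improvement-then w⇒w₁ (w′ , w₁⇒w′ , clique) = w′ , improvement-trans w⇒w₁ w₁⇒w′ , clique

  symmetrize : ∀ k (w : Weights n) → supportSize w ≤ k → Symmetrized w
  symmetrize zero w size≤0 = w , improvement-refl , λ i j wi>0 → ⊥-elim (supportSize≤0⇒¬positive w size≤0 i wi>0)
  symmetrize (suc k) w size≤k+1 with nonEdgeInSupport? w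
  ... | no no-non-edge = w , improvement-refl , supportIsClique w no-non-edge
  ... | yes (u , v , (wu>0 , wv>0) , (u≢v , uv∉E))
    with cliqueSum n adj (restrict (adj v) w) s ≤? cliqueSum n adj (restrict (adj u) w) s
  ...   | yes Cᵥ≤Cᵤ = improvement-then M.improvement (symmetrize k M.merged (≤-pred (≤-trans M.supportSize-< size≤k+1)))
    where module M = Merge w u v u≢v uv∉E wu>0 wv>0 Cᵥ≤Cᵤ
  ...   | no  Cᵥ≰Cᵤ = improvement-then M.improvement (symmetrize k M.merged (≤-pred (≤-trans M.supportSize-< size≤k+1)))
    where module M = Merge w v u (≢-sym u≢v) (trans (sym-adj v u) uv∉E) wv>0 wu>0 (≰⇒≥ Cᵥ≰Cᵤ)

module Transfer {m} (w : Weights m) (i j : Fin m) (i≢j : i ≢ j) (p : ℕ) (wi≡ : w i ≡ suc p) (wj≤p : w j ≤ p) where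

  private
    lowered : Weights m
    lowered = update w i p

  transferred : Weights m
  transferred = update lowered j (suc (w j))

  private
    j≢i : j ≢ i
    j≢i j≡i = i≢j (sym j≡i)

    transferred-i : transferred i ≡ p
    transferred-i = trans (update-other lowered (suc (w j)) i≢j) (update-self w i p)

    transferred-j : transferred j ≡ suc (w j)
    transferred-j = update-self lowered j (suc (w j))

  sum-transfer : ∀ (f : ℕ → ℕ) → sum (λ k → f (transferred k)) + f (w j) + f (w i)
                                    ≡ sum (λ k → f (w k)) + f p + f (suc (w j))
  sum-transfer f = begin
    sum (λ k → f (transferred k)) + f (w j) + f (w i)     ≡⟨ cong (λ z → sum (λ k → f (transferred k)) + f z + f (w i)) (sym (update-other w p j≢i)) ⟩
    sum (λ k → f (transferred k)) + f (lowered j) + f (w i) ≡⟨ cong (_+ f (w i)) (sum-update-map f lowered j (suc (w j))) ⟩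
    sum (λ k → f (lowered k)) + f (suc (w j)) + f (w i)  ≡⟨ exchange (sum (λ k → f (lowered k))) (f (suc (w j))) (f (w i)) ⟩
    (sum (λ k → f (lowered k)) + f (w i)) + f (suc (w j)) ≡⟨ cong (_+ f (suc (w j))) (sum-update-map f w i p) ⟩
    sum (λ k → f (w k)) + f p + f (suc (w j))            ∎
    where
    open ≡-Reasoning
    exchange : ∀ a b c → a + b + c ≡ (a + c) + b
    exchange = solve-∀

  sum-transferred : sum transferred ≡ sum w
  sum-transferred = +-cancelʳ-≡ (w j + w i) (sum transferred) (sum w) (begin
    sum transferred + (w j + w i)     ≡⟨ +-assoc (sum transferred) _ _ ⟨
    sum transferred + w j + w i       ≡⟨ sum-transfer (λ x → x) ⟩
    sum w + p + suc (w j)             ≡⟨ exchange (sum w) p (w j) ⟩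
    sum w + (w j + suc p)             ≡⟨ cong (λ z → sum w + (w j + z)) (sym wi≡) ⟩
    sum w + (w j + w i)               ∎)
    where
    open ≡-Reasoning
    exchange : ∀ a p q → a + p + suc q ≡ a + (q + suc p)
    exchange = solve-∀

  private
    erase-pair : ∀ k → erase i (erase j transferred) k ≡ erase i (erase j w) k
    erase-pair k = by-cases (k ≟ i) (k ≟ j)
      where
      by-cases : Dec (k ≡ i) → Dec (k ≡ j) → erase i (erase j transferred) k ≡ erase i (erase j w) k
      by-cases (yes refl) _          = trans (erase-self (erase j transferred) i) (sym (erase-self (erase j w) i))
      by-cases (no k≢i)   (yes refl) = trans (erase-other (erase j transferred) k≢i)
                                         (trans (erase-self transferred j) (sym (trans (erase-other (erase j w) k≢i) (erase-self w j))))
      by-cases (no k≢i)   (no k≢j)   = trans (erase-other (erase j transferred) k≢i) (trans (erase-other transferred k≢j)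
                                         (trans (trans (update-other lowered _ k≢j) (update-other w p k≢i))
                                                (sym (trans (erase-other (erase j w) k≢i) (erase-other w k≢j)))))

    -- (p + 1) * q ≤ p * (q + 1) as q ≤ p: the mixed coefficient grows, the linear one is unchanged.
    pair-coefficients : ∀ a b c → a + (suc p + w j) * b + (suc p * w j) * c ≤ a + (p + suc (w j)) * b + (p * suc (w j)) * c
    pair-coefficients a b c rewrite +-suc p (w j) =
      +-monoʳ-≤ (a + (suc p + w j) * b) (*-monoˡ-≤ c (begin
        suc p * w j    ≡⟨ +-comm (w j) (p * w j) ⟩
        p * w j + w j  ≤⟨ +-monoʳ-≤ (p * w j) wj≤p ⟩
        p * w j + p    ≡⟨ trans (+-comm (p * w j) p) (sym (*-suc p (w j))) ⟩
        p * suc (w j)  ∎))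
      where open ≤-Reasoning

  cliqueSum-≤-transferred : ∀ s → cliqueSum m (completeAdj m) w s ≤ cliqueSum m (completeAdj m) transferred s
  cliqueSum-≤-transferred zero          = ≤-refl
  cliqueSum-≤-transferred (suc zero)    =
    ≤-reflexive (trans (cliqueSum-one m _ w) (trans (sym sum-transferred) (sym (cliqueSum-one m _ transferred))))
  cliqueSum-≤-transferred (suc (suc s)) = begin
    Q w (2 + s)
      ≡⟨ cliqueSum-complete-pair m w i j i≢j s ⟩
    Q Z (2 + s) + (w i + w j) * Q Z (suc s) + (w i * w j) * Q Z s
      ≡⟨ cong (λ x → Q Z (2 + s) + (x + w j) * Q Z (suc s) + (x * w j) * Q Z s) wi≡ ⟩
    Q Z (2 + s) + (suc p + w j) * Q Z (suc s) + (suc p * w j) * Q Z s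
      ≤⟨ pair-coefficients (Q Z (2 + s)) (Q Z (suc s)) (Q Z s) ⟩
    Q Z (2 + s) + (p + suc (w j)) * Q Z (suc s) + (p * suc (w j)) * Q Z s
      ≡⟨ cong₂ (λ x y → Q Z (2 + s) + (x + y) * Q Z (suc s) + (x * y) * Q Z s) transferred-i transferred-j ⟨
    Q Z (2 + s) + (transferred i + transferred j) * Q Z (suc s) + (transferred i * transferred j) * Q Z s
      ≡⟨ cong₃ (λ x y z → x + (transferred i + transferred j) * y + (transferred i * transferred j) * z)
               (same (2 + s)) (same (suc s)) (same s) ⟨
    Q Z′ (2 + s) + (transferred i + transferred j) * Q Z′ (suc s) + (transferred i * transferred j) * Q Z′ s
      ≡⟨ cliqueSum-complete-pair m transferred i j i≢j s ⟨
    Q transferred (2 + s) ∎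
    where
    open ≤-Reasoning
    Q = cliqueSum m (completeAdj m)
    Z  = erase i (erase j w)
    Z′ = erase i (erase j transferred)
    same : ∀ s → Q Z′ s ≡ Q Z s
    same = cliqueSum-congʷ m (completeAdj m) erase-pair
    cong₃ : ∀ (f : ℕ → ℕ → ℕ → ℕ) {x x′ y y′ z z′} → x ≡ x′ → y ≡ y′ → z ≡ z′ → f x y z ≡ f x′ y′ z′
    cong₃ f refl refl refl = refl

excess : ∀ {m} → ℕ → Weights m → ℕ
excess b w = sum (λ k → w k ∸ b)

module Balancing {m : ℕ} (b : ℕ) where

  private
    Q = cliqueSum m (completeAdj m)

  capped-bound : ∀ r (w : Weights m) → (∀ k → w k ≤ b) → supportSize w ≤ r → ∀ s → Q w s ≤ binomial r s * b ^ s
  capped-bound r w capped size≤r s = begin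
    Q w s                                                   ≤⟨ cliqueSum-mono m _ (λ k → below-cap (w k) (capped k)) s ⟩
    Q (restrict (λ k → positive (w k)) (λ _ → b)) s         ≡⟨ cliqueSum-complete-const m (λ k → positive (w k)) b s ⟩
    binomial (countFin m (λ k → positive (w k))) s * b ^ s  ≤⟨ *-monoˡ-≤ (b ^ s) (binomial-monoˡ s support≤r) ⟩
    binomial r s * b ^ s                                    ∎
    where
    open ≤-Reasoning
    below-cap : ∀ x → x ≤ b → x ≤ (if positive x then b else 0)
    below-cap zero    _   = z≤n
    below-cap (suc x) x≤b = x≤b
    support≤r : countFin m (λ k → positive (w k)) ≤ r
    support≤r = subst (_≤ r) (sym (countFin≡sum m (λ k → positive (w k)))) size≤r

  b*supportSize<sum : ∀ (w : Weights m) → (∀ k → 0 < w k → b ≤ w k) → ∀ i → b < w i → b * supportSize w < sum w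
  b*supportSize<sum w above-cap i wi>b = begin-strict
    b * supportSize w                        ≡⟨ *-distribˡ-sum b (λ k → 𝟙 (positive (w k))) ⟩
    sum (λ k → b * 𝟙 (positive (w k)))       <⟨ sum-mono-< weighted-count i (subst (_< w i) (sym (b*𝟙-positive i wi>0)) wi>b) ⟩
    sum w                                    ∎
    where
    open ≤-Reasoning
    wi>0 : 0 < w i
    wi>0 = ≤-trans (s≤s z≤n) wi>b
    b*𝟙-positive : ∀ k → 0 < w k → b * 𝟙 (positive (w k)) ≡ b
    b*𝟙-positive k wk>0 = trans (cong (λ z → b * 𝟙 z) (positive-true wk>0)) (*-identityʳ b)
    weighted-count : ∀ k → b * 𝟙 (positive (w k)) ≤ w k
    weighted-count k with w k in wk≡
    ... | zero  = ≤-reflexive (*-zeroʳ b)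
    ... | suc x = subst (_≤ suc x) (sym (*-identityʳ b)) (subst (b ≤_) wk≡ (above-cap k (subst (0 <_) (sym wk≡) (s≤s z≤n))))

  zero-weight : ∀ (w : Weights m) → supportSize w < m → ∃ λ j → w j ≡ 0
  zero-weight w size<m with any? (λ j → w j ≟ℕ 0)
  ... | yes found = found
  ... | no  none  = ⊥-elim (<-irrefl full size<m)
    where
    all-positive : ∀ k → 𝟙 (positive (w k)) ≡ 1
    all-positive k with w k in wk≡
    ... | zero  = ⊥-elim (none (k , wk≡))
    ... | suc _ = refl
    full : supportSize w ≡ m
    full = trans (sum-cong-≗ all-positive) (trans (sum-const m 1) (*-identityʳ m))

  -- Where the unit taken from an overloaded vertex can go without enlarging the support beyond r.
  receiver : ∀ r → r ≤ m → (w : Weights m) → supportSize w ≤ r → sum w ≤ r * b → ∀ i → b < w i →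
             ∃ λ j → w j < b × (0 < w j ⊎ supportSize w < r)
  receiver r r≤m w size≤r sum≤rb i wi>b with any? (λ j → (0 <? w j) ×-dec (w j <? b))
  ... | yes (j , wj>0 , wj<b) = j , wj<b , inj₁ wj>0
  ... | no  no-light with r ≤? supportSize w
  ...   | yes r≤size = ⊥-elim (<-irrefl refl (begin-strict
          r * b                  ≤⟨ *-monoˡ-≤ b r≤size ⟩
          supportSize w * b      ≡⟨ *-comm (supportSize w) b ⟩
          b * supportSize w      <⟨ b*supportSize<sum w heavy i wi>b ⟩
          sum w                  ≤⟨ sum≤rb ⟩
          r * b                  ∎))
    where
    open ≤-Reasoning
    heavy : ∀ k → 0 < w k → b ≤ w k
    heavy k wk>0 = ≮⇒≥ (λ wk<b → no-light (k , wk>0 , wk<b))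
  ...   | no  r≰size with zero-weight w (<-≤-trans (≰⇒> r≰size) r≤m)
  ...     | j , wj≡0 = j , subst (_< b) (sym wj≡0) b>0 , inj₂ (≰⇒> r≰size)
    where
    b>0 : 0 < b
    b>0 = n≢0⇒n>0 λ b≡0 → <-irrefl (trans (sym (*-zeroʳ r)) (cong (r *_) (sym b≡0))) rb>0
      where rb>0 : 0 < r * b
            rb>0 = ≤-trans (≤-trans (s≤s z≤n) wi>b) (≤-trans (term≤sum w i) sum≤rb)

  module Step (w : Weights m) (i j : Fin m) (i≢j : i ≢ j) (p : ℕ) (wi≡ : w i ≡ suc p) (b≤p : b ≤ p) (wj<b : w j < b) where
    open Transfer w i j i≢j p wi≡ (≤-trans (<⇒≤ wj<b) b≤p) public

    excess-decreases : suc (excess b transferred) ≡ excess b w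
    excess-decreases = +-cancelˡ-≡ (p ∸ b) _ _ (begin
      p ∸ b + suc E′                          ≡⟨ shuffle (p ∸ b) E′ ⟩
      E′ + 0 + suc (p ∸ b)                    ≡⟨ cong₂ (λ x y → E′ + x + y) (sym (m≤n⇒m∸n≡0 (<⇒≤ (≤-trans (n<1+n (w j)) wj<b))))
                                                                            (trans (sym (+-∸-assoc 1 b≤p)) (cong (_∸ b) (sym wi≡))) ⟩
      E′ + (w j ∸ b) + (w i ∸ b)              ≡⟨ sum-transfer (_∸ b) ⟩
      excess b w + (p ∸ b) + (suc (w j) ∸ b)  ≡⟨ cong (excess b w + (p ∸ b) +_) (m≤n⇒m∸n≡0 wj<b) ⟩
      excess b w + (p ∸ b) + 0                ≡⟨ shuffle′ (excess b w) (p ∸ b) ⟩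
      p ∸ b + excess b w                      ∎)
      where
      open ≡-Reasoning
      E′ = excess b transferred
      shuffle : ∀ a c → a + suc c ≡ c + 0 + suc a
      shuffle = solve-∀
      shuffle′ : ∀ a c → a + c + 0 ≡ c + a
      shuffle′ = solve-∀

    supportSize-transferred : supportSize transferred + 𝟙 (positive (w j)) ≤ supportSize w + 1
    supportSize-transferred = begin
      supportSize transferred + 𝟙 (positive (w j))   ≡⟨ +-cancelʳ-≡ 1 _ _ count ⟩
      supportSize w + 𝟙 (positive p)                 ≤⟨ +-monoʳ-≤ (supportSize w) (𝟙≤1 (positive p)) ⟩
      supportSize w + 1                              ∎
      where
      open ≤-Reasoning
      count : supportSize transferred + 𝟙 (positive (w j)) + 1 ≡ supportSize w + 𝟙 (positive p) + 1
      count = trans (cong (λ x → supportSize transferred + 𝟙 (positive (w j)) + 𝟙 (positive x)) (sym wi≡))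
                    (sum-transfer (λ x → 𝟙 (positive x)))

  -- Maclaurin-type bound, by induction on the excess over the cap b.
  complete-bound : ∀ r → r ≤ m → ∀ k (w : Weights m) → excess b w ≤ k → supportSize w ≤ r → sum w ≤ r * b →
                   ∀ s → Q w s ≤ binomial r s * b ^ s
  complete-bound r r≤m zero w excess≤0 size≤r sum≤rb s =
    capped-bound r w (λ k → m∸n≡0⇒m≤n (n≤0⇒n≡0 (≤-trans (term≤sum (λ k → w k ∸ b) k) excess≤0))) size≤r s
  complete-bound r r≤m (suc k) w excess≤k+1 size≤r sum≤rb s with all? (λ k → w k ≤? b)
  ... | yes capped = capped-bound r w capped size≤r s
  ... | no  uncapped with ¬∀⟶∃¬ m _ (λ k → w k ≤? b) uncapped
  ... | i , wi≰b with w i in wi≡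
  ... | zero  = ⊥-elim (wi≰b z≤n)
  ... | suc p with receiver r r≤m w size≤r sum≤rb i (subst (b <_) (sym wi≡) (≰⇒> wi≰b))
  ... | j , wj<b , fresh = ≤-trans (S.cliqueSum-≤-transferred s)
          (complete-bound r r≤m k S.transferred (≤-pred (subst (_≤ suc k) (sym S.excess-decreases) excess≤k+1))
            (support′ fresh) (subst (_≤ r * b) (sym S.sum-transferred) sum≤rb) s)
    where
    b≤p : b ≤ p
    b≤p = ≤-pred (≰⇒> wi≰b)
    i≢j : i ≢ j
    i≢j refl = 1+n≰n (≤-trans (<⇒≤ (subst (_< b) wi≡ wj<b)) b≤p)
    module S = Step w i j i≢j p wi≡ b≤p wj<b
    support′ : 0 < w j ⊎ supportSize w < r → supportSize S.transferred ≤ r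
    support′ (inj₁ wj>0) = ≤-trans (+-cancelʳ-≤ 1 _ _ (subst (λ x → supportSize S.transferred + x ≤ supportSize w + 1)
                                                         (cong 𝟙 (positive-true wj>0)) S.supportSize-transferred)) size≤r
    support′ (inj₂ size<r) = ≤-trans (m≤m+n _ _) (≤-trans S.supportSize-transferred (subst (_≤ r) (+-comm 1 _) size<r))

-- A clique inside the neighbourhood of v extends by v, hence has at most ω − 1 vertices.
supportSize-in-neighbourhood : ∀ n (adj : Adj n) → Symmetric adj → Irreflexive adj → ∀ r → CliqueNumber≤ adj (suc r) →
  (v : Fin n) (w : Weights n) → (∀ j → 0 < w j → adj v j ≡ true) → SupportIsClique adj w → supportSize w ≤ r
supportSize-in-neighbourhood n adj sym-adj irr r ω≤ v w in-N clique =
  +-cancelʳ-≤ 1 _ _ (subst (_≤ r + 1) size-S (subst₂ _≤_ (size-tabulate n g) (+-comm 1 r)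
    (ω≤ (tabulate g) (IsClique⇒isClique adj (tabulate g) clique-S))))
  where
  g : Fin n → Bool
  g i = positive (w i) ∨ ⌊ i ≟ v ⌋
  positive-true⇒ : ∀ {x} → positive x ≡ true → 0 < x
  positive-true⇒ {suc x} _ = s≤s z≤n
  in-support : ∀ {i} → lookup (tabulate g) i ≡ true → i ≢ v → 0 < w i
  in-support {i} i∈S i≢v with positive (w i) in wi>0 | trans (sym (lookup∘tabulate g i)) i∈S
  ... | true  | _ = positive-true⇒ wi>0
  ... | false | g≡true rewrite ≟-≢ i≢v with () ← g≡true
  clique-S : IsClique adj (tabulate g)
  clique-S i j i∈S j∈S i≢j with i ≟ v | j ≟ v
  ... | yes refl | yes refl = ⊥-elim (i≢j refl)
  ... | yes refl | no j≢v   = in-N j (in-support j∈S j≢v)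
  ... | no i≢v   | yes refl = trans (sym-adj i v) (in-N i (in-support i∈S i≢v))
  ... | no i≢v   | no j≢v   = clique i j (in-support i∈S i≢v) (in-support j∈S j≢v) i≢j
  wv≯0 : positive (w v) ≡ false
  wv≯0 with w v in wv≡
  ... | zero  = refl
  ... | suc _ = ⊥-elim (true≢false (trans (sym (in-N v (subst (0 <_) (sym wv≡) (s≤s z≤n)))) (irr v)))
  𝟙-∨ : ∀ x b → 𝟙 (x ∨ b) ≡ (if b then 1 else 𝟙 x)
  𝟙-∨ true  true  = refl
  𝟙-∨ true  false = refl
  𝟙-∨ false _     = refl
  size-S : countFin n g ≡ supportSize w + 1
  size-S = begin
    countFin n g                                             ≡⟨ countFin≡sum n g ⟩
    sum (λ i → 𝟙 (g i))                                      ≡⟨ sum-cong-≗ (λ i → 𝟙-∨ (positive (w i)) ⌊ i ≟ v ⌋) ⟩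
    sum (update (λ i → 𝟙 (positive (w i))) v 1)             ≡⟨ +-identityʳ _ ⟨
    sum (update (λ i → 𝟙 (positive (w i))) v 1) + 𝟙 false   ≡⟨ cong (λ b → sum (update (λ i → 𝟙 (positive (w i))) v 1) + 𝟙 b) wv≯0 ⟨
    sum (update (λ i → 𝟙 (positive (w i))) v 1) + 𝟙 (positive (w v)) ≡⟨ sum-update (λ i → 𝟙 (positive (w i))) v 1 ⟩
    supportSize w + 1                                        ∎
    where open ≡-Reasoning

neighbourhood-bound : ∀ n (adj : Adj n) → Symmetric adj → Irreflexive adj → ∀ r b s → CliqueNumber≤ adj (suc r) →
  (v : Fin n) → countFin n (adj v) ≤ r * b → cliqueSum n adj (restrict (adj v) (λ _ → 1)) (suc s) ≤ binomial r (suc s) * b ^ suc s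
neighbourhood-bound n adj sym-adj irr r b s ω≤ v deg≤ = bound (symmetrize n w₀ support₀≤n)
  where
  open Symmetrization adj sym-adj irr s
  w₀ = restrict (adj v) (λ _ → 1)
  support₀≤n : supportSize w₀ ≤ n
  support₀≤n = ≤-trans (sum-mono-≤ (λ i → 𝟙≤1 (positive (w₀ i)))) (≤-reflexive (trans (sum-const n 1) (*-identityʳ n)))
  bound : Symmetrized w₀ → cliqueSum n adj w₀ (suc s) ≤ binomial r (suc s) * b ^ suc s
  bound (w′ , improvement , clique) = begin
    cliqueSum n adj w₀ (suc s)                                         ≤⟨ cliqueSum-≤ improvement ⟩
    cliqueSum n adj w′ (suc s)                                         ≡⟨ cliqueSum-supportIsClique n adj w′ clique (suc s) ⟩
    cliqueSum n (completeAdj n) w′ (suc s)                             ≡⟨ cliqueSum-padZeros r n w′ (suc s) ⟩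
    cliqueSum (r + n) (completeAdj (r + n)) (padZeros r w′) (suc s)    ≤⟨ Balancing.complete-bound b r (m≤m+n r n) _ (padZeros r w′)
                                                                            ≤-refl support≤r sum≤rb (suc s) ⟩
    binomial r (suc s) * b ^ suc s                                     ∎
    where
    open ≤-Reasoning
    in-N : ∀ j → 0 < w′ j → adj v j ≡ true
    in-N j w′j>0 with adj v j | support-⊆ improvement j w′j>0
    ... | true | _ = refl
    support≤r : supportSize (padZeros r w′) ≤ r
    support≤r = subst (_≤ r) (sym (supportSize-padZeros r w′))
      (supportSize-in-neighbourhood n adj sym-adj irr r ω≤ v w′ in-N clique)
    sum≤rb : sum (padZeros r w′) ≤ r * b
    sum≤rb = subst (_≤ r * b) (sym (trans (sum-padZeros r w′) (trans (total-≡ improvement) (sym (countFin≡sum n (adj v)))))) deg≤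

kt-upper-bound : ∀ n (G : Graph n) Δ r b s → InClass Δ (suc r) G → Δ ≤ r * b →
  suc (suc s) * kt (suc (suc s)) (adj G) ≤ n * (binomial r (suc s) * b ^ suc s)
kt-upper-bound n G Δ r b s (deg≤Δ , ω≤) Δ≤rb = begin
  suc (suc s) * kt (suc (suc s)) (adj G)                        ≡⟨ cong (suc (suc s) *_) (kt≡cliqueSum n (adj G) (Graph.sym G) (suc (suc s))) ⟩
  suc (suc s) * cliqueSum n (adj G) (λ _ → 1) (suc (suc s))     ≡⟨ cliqueSum-handshake n (adj G) (Graph.sym G) (irrefl G) (λ _ → 1) (suc s) ⟩
  sum (λ v → 1 * cliqueSum n (adj G) (restrict (adj G v) (λ _ → 1)) (suc s))
    ≤⟨ sum-mono-≤ (λ v → ≤-trans (≤-reflexive (*-identityˡ _))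
         (neighbourhood-bound n (adj G) (Graph.sym G) (irrefl G) r b s ω≤ v (≤-trans (deg≤Δ v) Δ≤rb))) ⟩
  ∑[ _ < n ] (binomial r (suc s) * b ^ suc s)                   ≡⟨ sum-const n _ ⟩
  n * (binomial r (suc s) * b ^ suc s)                          ∎
  where open ≤-Reasoning

-- Turán graphs: the lower bound

module TuranGraph (r N : ℕ) where

  T : Adj N
  T = turanAdj (suc r) N

  part : Fin N → Fin (suc r)
  part i = fromℕ< (m%n<n (toℕ i) (suc r))

  toℕ-part : ∀ i → toℕ (part i) ≡ toℕ i % suc r
  toℕ-part i = toℕ-fromℕ< _

  T≡complete : ∀ i j → T i j ≡ completeAdj (suc r) (part i) (part j)
  T≡complete i j = cong not (trans (cong₂ _≡ᵇ_ (sym (toℕ-part i)) (sym (toℕ-part j))) (toℕ-≡ᵇ (part i) (part j)))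

  T-symmetric : Symmetric T
  T-symmetric i j = trans (T≡complete i j) (trans (completeAdj-symmetric _ (part i) (part j)) (sym (T≡complete j i)))

  T-irreflexive : Irreflexive T
  T-irreflexive i = trans (T≡complete i i) (completeAdj-irreflexive _ (part i))

  graph : Graph N
  graph = record { adj = T ; sym = T-symmetric ; irrefl = T-irreflexive }

  partSize : Fin (suc r) → ℕ
  partSize x = countFin N (λ i → ⌊ part i ≟ x ⌋)

  partSize-≥ : ∀ a → suc r * a ≤ N → ∀ x → a ≤ partSize x
  partSize-≥ a ra≤N x = begin
    a                                  ≤⟨ residue-class-size r (toℕ x) (toℕ<n x) a ⟩
    countℕ (a * suc r) f               ≤⟨ m≤m+n _ _ ⟩
    countℕ (a * suc r) f + countℕ (N ∸ a * suc r) (λ y → f (a * suc r + y))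
                                       ≡⟨ countℕ-+ (a * suc r) (N ∸ a * suc r) f ⟨
    countℕ (a * suc r + (N ∸ a * suc r)) f
                                       ≡⟨ cong (λ n → countℕ n f) (m+[n∸m]≡n (subst (_≤ N) (*-comm (suc r) a) ra≤N)) ⟩
    countℕ N f                         ≡⟨ countFin-toℕ N f ⟨
    countFin N (λ i → f (toℕ i))       ≡⟨ countFin-cong N (λ i → trans (cong (_≡ᵇ toℕ x) (sym (toℕ-part i))) (toℕ-≡ᵇ (part i) x)) ⟩
    partSize x                         ∎
    where
    open ≤-Reasoning
    f : ℕ → Bool
    f y = y % suc r ≡ᵇ toℕ x

  degree+partSize : ∀ v → countFin N (T v) + partSize (part v) ≡ N
  degree+partSize v = begin
    countFin N (T v) + partSize (part v)
      ≡⟨ cong₂ _+_ (countFin≡sum N (T v)) (countFin≡sum N (λ i → ⌊ part i ≟ part v ⌋)) ⟩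
    sum (λ i → 𝟙 (T v i)) + sum (λ i → 𝟙 ⌊ part i ≟ part v ⌋)
      ≡⟨ ∑-distrib-+ (λ i → 𝟙 (T v i)) (λ i → 𝟙 ⌊ part i ≟ part v ⌋) ⟨
    sum (λ i → 𝟙 (T v i) + 𝟙 ⌊ part i ≟ part v ⌋)
      ≡⟨ sum-cong-≗ one-of-two ⟩
    sum {N} (λ _ → 1)
      ≡⟨ trans (sum-const N 1) (*-identityʳ N) ⟩
    N ∎
    where
    open ≡-Reasoning
    𝟙-not+𝟙 : ∀ b → 𝟙 (not b) + 𝟙 b ≡ 1
    𝟙-not+𝟙 true  = refl
    𝟙-not+𝟙 false = refl
    one-of-two : ∀ i → 𝟙 (T v i) + 𝟙 ⌊ part i ≟ part v ⌋ ≡ 1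
    one-of-two i = trans (cong (λ z → 𝟙 z + 𝟙 ⌊ part i ≟ part v ⌋) (trans (T≡complete v i) (cong not (≟-sym (part v) (part i)))))
                         (𝟙-not+𝟙 ⌊ part i ≟ part v ⌋)

  cliqueNumber≤ : CliqueNumber≤ T (suc r)
  cliqueNumber≤ S clique with suc r <? size S
  ... | no  ≯ = ≮⇒≥ ≯
  ... | yes > = ⊥-elim (<-irrefl refl (begin-strict
    0                                                             <⟨ countList-allSubsets-≥1 N _ S S-counted ⟩
    cliquesWithin T (size S) (lookup S)                           ≡⟨ cliquesWithin≡cliqueSum N T T-symmetric (lookup S) (size S) ⟩
    cliqueSum N T (λ i → 𝟙 (lookup S i)) (size S)                 ≡⟨ cliqueSum-blowup N (suc r) T part T≡complete _ (size S) ⟩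
    cliqueSum (suc r) (completeAdj (suc r)) _ (size S)            ≡⟨ cliqueSum-too-large (suc r) (completeAdj (suc r)) _ (size S) > ⟩
    0                                                             ∎))
    where
    open ≤-Reasoning
    S-counted : (isClique T S ∧ (size S ≡ᵇ size S) ∧ (S ⊆ᵇ lookup S)) ≡ true
    S-counted = ∧-intro clique (∧-intro (≡ᵇ-refl (size S)) (⊆⇒⊆ᵇ S (lookup S) (λ _ j∈S → j∈S)))

  neighbourhood-lower-bound : ∀ a s → suc r * a ≤ N → ∀ v → binomial r s * a ^ s ≤ cliqueSum N T (restrict (T v) (λ _ → 1)) s
  neighbourhood-lower-bound a s ra≤N v = begin
    binomial r s * a ^ s
      ≡⟨ cong (λ k → binomial k s * a ^ s) (countFin-others r (part v)) ⟨
    binomial (countFin (suc r) (λ x → not ⌊ x ≟ part v ⌋)) s * a ^ s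
      ≡⟨ cliqueSum-complete-const (suc r) (λ x → not ⌊ x ≟ part v ⌋) a s ⟨
    cliqueSum (suc r) (completeAdj (suc r)) (restrict (λ x → not ⌊ x ≟ part v ⌋) (λ _ → a)) s
      ≤⟨ cliqueSum-mono (suc r) (completeAdj (suc r)) other-parts-≥ s ⟩
    cliqueSum (suc r) (completeAdj (suc r)) (partWeights part (restrict (T v) (λ _ → 1))) s
      ≡⟨ cliqueSum-blowup N (suc r) T part T≡complete _ s ⟨
    cliqueSum N T (restrict (T v) (λ _ → 1)) s ∎
    where
    open ≤-Reasoning
    other-parts-≥ : ∀ x → restrict (λ x → not ⌊ x ≟ part v ⌋) (λ _ → a) x ≤ partWeights part (restrict (T v) (λ _ → 1)) x
    other-parts-≥ x with x ≟ part v in x≟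
    ... | yes _   = z≤n
    ... | no  x≢v = ≤-trans (partSize-≥ a ra≤N x)
                      (≤-reflexive (trans (countFin≡sum N _) (sum-cong-≗ neighbour-in-part)))
      where
      neighbour-in-part : ∀ i → 𝟙 ⌊ part i ≟ x ⌋ ≡ (if ⌊ part i ≟ x ⌋ then restrict (T v) (λ _ → 1) i else 0)
      neighbour-in-part i with part i ≟ x
      ... | no  _       = refl
      ... | yes refl = cong (λ b → if b then 1 else 0)
                         (sym (trans (T≡complete v i) (cong not (≟-≢ (λ v≡i → x≢v (sym v≡i))))))

  degree≤ : ∀ Δ a → suc r * a ≤ N → N ≡ Δ + a → ∀ v → degree graph v ≤ Δ
  degree≤ Δ a ra≤N N≡ v = +-cancelʳ-≤ a _ _ (begin
    countFin N (T v) + a                  ≤⟨ +-monoʳ-≤ (countFin N (T v)) (partSize-≥ a ra≤N (part v)) ⟩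
    countFin N (T v) + partSize (part v)  ≡⟨ degree+partSize v ⟩
    N                                     ≡⟨ N≡ ⟩
    Δ + a                                 ∎)
    where open ≤-Reasoning

  kt-lower-bound : ∀ a s → suc r * a ≤ N → N * (binomial r (suc s) * a ^ suc s) ≤ suc (suc s) * kt (suc (suc s)) T
  kt-lower-bound a s ra≤N = begin
    N * (binomial r (suc s) * a ^ suc s)                       ≡⟨ sum-const N _ ⟨
    ∑[ _ < N ] (binomial r (suc s) * a ^ suc s)                ≤⟨ sum-mono-≤ (λ v → ≤-trans (neighbourhood-lower-bound a (suc s) ra≤N v)
                                                                                            (≤-reflexive (sym (*-identityˡ _)))) ⟩
    sum (λ v → 1 * cliqueSum N T (restrict (T v) (λ _ → 1)) (suc s))
      ≡⟨ cliqueSum-handshake N T T-symmetric T-irreflexive (λ _ → 1) (suc s) ⟨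
    suc (suc s) * cliqueSum N T (λ _ → 1) (suc (suc s))        ≡⟨ cong (suc (suc s) *_) (kt≡cliqueSum N T T-symmetric (suc (suc s))) ⟨
    suc (suc s) * kt (suc (suc s)) T                           ∎
    where open ≤-Reasoning

-- Comparing the two bounds

^-distribʳ-* : ∀ x y e → (x * y) ^ e ≡ x ^ e * y ^ e
^-distribʳ-* x y zero    = refl
^-distribʳ-* x y (suc e) = trans (cong ((x * y) *_) (^-distribʳ-* x y e)) (regroup x y (x ^ e) (y ^ e))
  where regroup : ∀ x y p q → x * y * (p * q) ≡ x * p * (y * q)
        regroup = solve-∀

-- Bernoulli-type: (a + 1)^k (a − k) ≤ a^(k+1), from (a + 1)(a − k − 1) ≤ a (a − k).
suc-pow-bound : ∀ a k → suc a ^ k * (a ∸ k) ≤ a ^ suc k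
suc-pow-bound a zero    = ≤-reflexive (trans (+-identityʳ a) (sym (*-identityʳ a)))
suc-pow-bound a (suc k) = begin
  suc a * suc a ^ k * (a ∸ suc k)    ≡⟨ regroup (suc a) (suc a ^ k) (a ∸ suc k) ⟩
  suc a ^ k * (suc a * (a ∸ suc k))  ≤⟨ *-monoʳ-≤ (suc a ^ k) (step (a ∸ k) refl) ⟩
  suc a ^ k * (a * (a ∸ k))          ≡⟨ x∙yz≈y∙xz (suc a ^ k) a (a ∸ k) ⟩
  a * (suc a ^ k * (a ∸ k))          ≤⟨ *-monoʳ-≤ a (suc-pow-bound a k) ⟩
  a * a ^ suc k                      ∎
  where
  open ≤-Reasoning
  regroup : ∀ x y z → x * y * z ≡ y * (x * z)
  regroup = solve-∀
  a∸[1+k] : ∀ {d} → a ∸ k ≡ d → a ∸ suc k ≡ pred d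
  a∸[1+k] {d} a∸k≡d = trans (sym (pred[m∸n]≡m∸[1+n] a k)) (cong pred a∸k≡d)
  step : ∀ d → a ∸ k ≡ d → suc a * (a ∸ suc k) ≤ a * (a ∸ k)
  step zero    a∸k≡0 rewrite a∸[1+k] a∸k≡0 | *-zeroʳ a = z≤n
  step (suc d) a∸k≡ rewrite a∸[1+k] a∸k≡ | a∸k≡ = begin
    suc a * d   ≡⟨ +-comm d (a * d) ⟩
    a * d + d   ≤⟨ +-monoʳ-≤ (a * d) (≤-trans (n≤1+n d) (subst (_≤ a) a∸k≡ (m∸n≤m a k))) ⟩
    a * d + a   ≡⟨ trans (+-comm (a * d) a) (sym (*-suc a d)) ⟩
    a * suc d   ∎

suc-pow-ratio : ∀ q a e → (q + 1) * suc e ≤ a → q * suc a ^ e ≤ (q + 1) * a ^ e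
suc-pow-ratio q a e large = *-cancelʳ-≤ (q * suc a ^ e) ((q + 1) * a ^ e) (a ∸ e) {{>-nonZero a∸e>0}} (begin
  q * suc a ^ e * (a ∸ e)       ≡⟨ *-assoc q _ _ ⟩
  q * (suc a ^ e * (a ∸ e))     ≤⟨ *-monoʳ-≤ q (suc-pow-bound a e) ⟩
  q * (a * a ^ e)               ≡⟨ *-assoc q a (a ^ e) ⟨
  q * a * a ^ e                 ≤⟨ *-monoˡ-≤ (a ^ e) qa≤[q+1][a∸e] ⟩
  (q + 1) * (a ∸ e) * a ^ e     ≡⟨ regroup (q + 1) (a ∸ e) (a ^ e) ⟩
  (q + 1) * a ^ e * (a ∸ e)     ∎)
  where
  open ≤-Reasoning
  regroup : ∀ x y p → x * y * p ≡ x * p * y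
  regroup = solve-∀
  [q+1]≡ : ∀ x → (q + 1) * x ≡ q * x + x
  [q+1]≡ x = trans (*-distribʳ-+ x q 1) (cong (q * x +_) (*-identityˡ x))
  [q+1]e≤a : (q + 1) * e ≤ a
  [q+1]e≤a = ≤-trans (*-monoʳ-≤ (q + 1) (n≤1+n e)) large
  a∸e>0 : 0 < a ∸ e
  a∸e>0 = subst (_≤ a ∸ e) (m+n∸n≡m 1 e) (∸-monoˡ-≤ e (≤-trans (subst (suc e ≤_) (sym ([q+1]≡ (suc e))) (m≤n+m (suc e) (q * suc e))) large))
  qa≤[q+1][a∸e] : q * a ≤ (q + 1) * (a ∸ e)
  qa≤[q+1][a∸e] = subst (q * a ≤_)
    (sym (trans (*-distribˡ-∸ (q + 1) a e) (trans (cong (_∸ (q + 1) * e) ([q+1]≡ a)) (+-∸-assoc (q * a) [q+1]e≤a))))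
    (m≤m+n (q * a) _)

module Estimates (r′ s q Δ : ℕ) (q≥1 : 1 ≤ q) (Δ-large : (q + 1) * suc (suc s) * suc r′ ≤ Δ) where

  r t e a N : ℕ
  r = suc r′
  t = suc (suc s)
  e = suc s
  a = Δ / r
  N = Δ + a

  open TuranGraph r N public

  kT B : ℕ
  kT = kt t T
  B  = binomial r e

  a-large : (q + 1) * t ≤ a
  a-large = subst (_≤ a) (m*n/n≡m ((q + 1) * t) r) (/-monoˡ-≤ r Δ-large)

  r*a≤Δ : r * a ≤ Δ
  r*a≤Δ = subst (_≤ Δ) (*-comm a r) (m/n*n≤m Δ r)

  Δ≤r*[a+1] : Δ ≤ r * suc a
  Δ≤r*[a+1] = begin
    Δ                  ≡⟨ m≡m%n+[m/n]*n Δ r ⟩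
    Δ % r + a * r      ≤⟨ +-monoˡ-≤ (a * r) (<⇒≤ (m%n<n Δ r)) ⟩
    r + a * r          ≡⟨ trans (cong (r +_) (*-comm a r)) (sym (*-suc r a)) ⟩
    r * suc a          ∎
    where open ≤-Reasoning

  [r+1]*a≤N : suc r * a ≤ N
  [r+1]*a≤N = ≤-trans (+-monoʳ-≤ a r*a≤Δ) (≤-reflexive (+-comm a Δ))

  turan-in-class : InClass Δ (suc r) graph
  turan-in-class = degree≤ Δ a [r+1]*a≤N refl , cliqueNumber≤

  turan-lower : N * (B * a ^ e) ≤ t * kT
  turan-lower = kt-lower-bound a s [r+1]*a≤N

  turan-upper : t * kT ≤ N * (B * suc a ^ e)
  turan-upper = kt-upper-bound N graph Δ r (suc a) s turan-in-class Δ≤r*[a+1]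

  ratio : q * suc a ^ e ≤ (q + 1) * a ^ e
  ratio = suc-pow-ratio q a e a-large

  q∸1+1≡q : q ∸ 1 + 1 ≡ q
  q∸1+1≡q = m∸n+n≡m q≥1

  ratio′ : (q ∸ 1) * suc a ^ e ≤ q * a ^ e
  ratio′ = subst (λ x → (q ∸ 1) * suc a ^ e ≤ x * a ^ e) q∸1+1≡q
    (suc-pow-ratio (q ∸ 1) a e (≤-trans (*-monoˡ-≤ t (≤-trans (≤-reflexive q∸1+1≡q) (m≤m+n q 1))) a-large))

  graph-bound : ∀ n (G : Graph n) → InClass Δ (suc r) G → q * N * kt t (adj G) ≤ (q + 1) * n * kT
  graph-bound n G G∈𝒢 = *-cancelˡ-≤ t (begin
    t * (q * N * kG)               ≡⟨ regroup₁ t q N kG ⟩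
    q * N * (t * kG)               ≤⟨ *-monoʳ-≤ (q * N) (kt-upper-bound n G Δ r (suc a) s G∈𝒢 Δ≤r*[a+1]) ⟩
    q * N * (n * (B * suc a ^ e))  ≡⟨ regroup₂ q N n B (suc a ^ e) ⟩
    n * N * B * (q * suc a ^ e)    ≤⟨ *-monoʳ-≤ (n * N * B) ratio ⟩
    n * N * B * ((q + 1) * a ^ e)  ≡⟨ regroup₃ n N B q (a ^ e) ⟩
    (q + 1) * n * (N * (B * a ^ e)) ≤⟨ *-monoʳ-≤ ((q + 1) * n) turan-lower ⟩
    (q + 1) * n * (t * kT)         ≡⟨ regroup₄ q n t kT ⟩
    t * ((q + 1) * n * kT)         ∎)
    where
    open ≤-Reasoning
    kG = kt t (adj G)
    regroup₁ : ∀ t q N k → t * (q * N * k) ≡ q * N * (t * k)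
    regroup₁ = solve-∀
    regroup₂ : ∀ q N n B x → q * N * (n * (B * x)) ≡ n * N * B * (q * x)
    regroup₂ = solve-∀
    regroup₃ : ∀ n N B q y → n * N * B * ((q + 1) * y) ≡ (q + 1) * n * (N * (B * y))
    regroup₃ = solve-∀
    regroup₄ : ∀ q n t k → (q + 1) * n * (t * k) ≡ t * ((q + 1) * n * k)
    regroup₄ = solve-∀

  turan-density-upper : q * kT * t * r ^ e ≤ (q + 1) * N * (r C e) * Δ ^ e
  turan-density-upper = subst (λ c → q * kT * t * r ^ e ≤ (q + 1) * N * c * Δ ^ e) (binomial≡C r e) (begin
    q * kT * t * r ^ e                 ≡⟨ regroup₁ q kT t (r ^ e) ⟩
    q * (t * kT) * r ^ e               ≤⟨ *-monoˡ-≤ (r ^ e) (*-monoʳ-≤ q turan-upper) ⟩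
    q * (N * (B * suc a ^ e)) * r ^ e  ≡⟨ regroup₂ q N B (suc a ^ e) (r ^ e) ⟩
    N * B * r ^ e * (q * suc a ^ e)    ≤⟨ *-monoʳ-≤ (N * B * r ^ e) ratio ⟩
    N * B * r ^ e * ((q + 1) * a ^ e)  ≡⟨ regroup₃ N B (r ^ e) q (a ^ e) ⟩
    (q + 1) * N * B * (r ^ e * a ^ e)  ≡⟨ cong ((q + 1) * N * B *_) (^-distribʳ-* r a e) ⟨
    (q + 1) * N * B * (r * a) ^ e      ≤⟨ *-monoʳ-≤ ((q + 1) * N * B) (^-monoˡ-≤ e r*a≤Δ) ⟩
    (q + 1) * N * B * Δ ^ e            ∎)
    where
    open ≤-Reasoning
    regroup₁ : ∀ q k t R → q * k * t * R ≡ q * (t * k) * R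
    regroup₁ = solve-∀
    regroup₂ : ∀ q N B x R → q * (N * (B * x)) * R ≡ N * B * R * (q * x)
    regroup₂ = solve-∀
    regroup₃ : ∀ N B R q y → N * B * R * ((q + 1) * y) ≡ (q + 1) * N * B * (R * y)
    regroup₃ = solve-∀

  turan-density-lower : (q ∸ 1) * N * (r C e) * Δ ^ e ≤ q * kT * t * r ^ e
  turan-density-lower = subst (λ c → (q ∸ 1) * N * c * Δ ^ e ≤ q * kT * t * r ^ e) (binomial≡C r e) (begin
    (q ∸ 1) * N * B * Δ ^ e                  ≤⟨ *-monoʳ-≤ ((q ∸ 1) * N * B) (^-monoˡ-≤ e Δ≤r*[a+1]) ⟩
    (q ∸ 1) * N * B * (r * suc a) ^ e        ≡⟨ cong ((q ∸ 1) * N * B *_) (^-distribʳ-* r (suc a) e) ⟩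
    (q ∸ 1) * N * B * (r ^ e * suc a ^ e)    ≡⟨ regroup₁ (q ∸ 1) N B (r ^ e) (suc a ^ e) ⟩
    N * B * r ^ e * ((q ∸ 1) * suc a ^ e)    ≤⟨ *-monoʳ-≤ (N * B * r ^ e) ratio′ ⟩
    N * B * r ^ e * (q * a ^ e)              ≡⟨ regroup₂ N B (r ^ e) q (a ^ e) ⟩
    q * (N * (B * a ^ e)) * r ^ e            ≤⟨ *-monoˡ-≤ (r ^ e) (*-monoʳ-≤ q turan-lower) ⟩
    q * (t * kT) * r ^ e                     ≡⟨ regroup₃ q t kT (r ^ e) ⟩
    q * kT * t * r ^ e                       ∎)
    where
    open ≤-Reasoning
    regroup₁ : ∀ p N B R x → p * N * B * (R * x) ≡ N * B * R * (p * x)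
    regroup₁ = solve-∀
    regroup₂ : ∀ N B R q y → N * B * R * (q * y) ≡ q * (N * (B * y)) * R
    regroup₂ = solve-∀
    regroup₃ : ∀ q t k R → q * (t * k) * R ≡ q * k * t * R
    regroup₃ = solve-∀

theorem3p6 : (t ω : ℕ) → 2 ≤ t → 2 ≤ ω →
    (q : ℕ) → 1 ≤ q →
    ∃[ D ] ((Δ : ℕ) → D ≤ Δ → 2 ≤ Δ →
      ((n : ℕ) → (G : Graph n) → InClass Δ ω G →
        q * (Δ + divℕ Δ (ω ∸ 1)) * kt t (adj G)
          ≤ (q + 1) * n * kt t (turanAdj ω (Δ + divℕ Δ (ω ∸ 1))))
      × (∃[ n ] ∃[ G ] (1 ≤ n × InClass {n} Δ ω G
          × (q ∸ 1) * n * kt t (turanAdj ω (Δ + divℕ Δ (ω ∸ 1)))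
              ≤ q * (Δ + divℕ Δ (ω ∸ 1)) * kt t (adj G)))
      × (q * kt t (turanAdj ω (Δ + divℕ Δ (ω ∸ 1))) * t * (ω ∸ 1) ^ (t ∸ 1)
          ≤ (q + 1) * (Δ + divℕ Δ (ω ∸ 1)) * ((ω ∸ 1) C (t ∸ 1)) * Δ ^ (t ∸ 1))
      × ((q ∸ 1) * (Δ + divℕ Δ (ω ∸ 1)) * ((ω ∸ 1) C (t ∸ 1)) * Δ ^ (t ∸ 1)
          ≤ q * kt t (turanAdj ω (Δ + divℕ Δ (ω ∸ 1))) * t * (ω ∸ 1) ^ (t ∸ 1)))
theorem3p6 (suc (suc s)) (suc (suc r′)) (s≤s (s≤s _)) (s≤s (s≤s _)) q q≥1 =
  (q + 1) * suc (suc s) * suc r′ , λ Δ Δ-large Δ≥2 →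
    let open Estimates r′ s q Δ q≥1 Δ-large in
      graph-bound
    , (N , graph , ≤-trans (≤-trans (s≤s z≤n) Δ≥2) (m≤m+n Δ a) , turan-in-class , *-monoˡ-≤ kT (*-monoˡ-≤ N (m∸n≤m q 1)))
    , turan-density-upper
    , turan-density-lower
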